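{- A feasible set $U$ is linearly independent in $W$ if and only if every connected component $Z\in\mathcal{Z}(U)$ satisfies all of the following: (a) the subgraph of $G[U]$ induced by $Z$ is a tree; (b) $|Z\cap S|\le 1$ for every block $S\in\mathcal{S}$; (c) $|Z\cap T|+|Z\cap T[U]|\le 2$.
   Context: Let $G=(V,E)$ be a finite simple connected undirected graph, $T\subseteq V$ a set of terminals with $|T|=k$, $|V|=n$, and $\mathcal{S}$ a partition of $T$ into non-empty blocks with $|\mathcal{S}|\ge 2$. Let $q$ be the least prime with $|\mathcal{S}|<q\le 2|\mathcal{S}|$, and let $\theta:T\to\mathbb{F}_q$ satisfy $\theta(t)=\theta(t')$ iff $t,t'$ lie in the same block. For each edge $e\in E$ fix a bijection $\mu_e:e\to\{1,-1\}\subseteq\mathbb{F}_q$. Let $W$ be the $(2n-k)$-dimensional $\mathbb{F}_q$-vector space with basis consisting of a vector $\mathbf{t}$ (a "singleton") for each $t\in T$ and two vectors $\mathbf{v}^\circ,\mathbf{v}^\bullet$ for each $v\in V\setminus T$. For $t\in T$ set $\mathbf{t}^\circ:=\mathbf{t}$, $\mathbf{t}^\bullet:=\theta(t)\mathbf{t}$. For each edge $e=\{u,v\}$ set $\mathbf{e}^\circ:=\mu_e(u)\mathbf{u}^\circ+\mu_e(v)\mathbf{v}^\circ$, $\mathbf{e}^\bullet:=\mu_e(u)\mathbf{u}^\bullet+\mu_e(v)\mathbf{v}^\bullet$. A set of vectors $U$ is feasible if $U=\{\mathbf{t}\mid t\in S\}\cup\{\mathbf{e}^\circ,\mathbf{e}^\bullet\mid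 e\in F\}$ for some $S\subseteq T$, $F\subseteq E$. For feasible $U$ define $T[U]:=\{t\in T\mid \mathbf{t}\in U\}$, $E[U]:=\{e\in E\mid \mathbf{e}^\circ,\mathbf{e}^\bullet\in U\}$, $G[U]:=(V,E[U])$, and let $\mathcal{Z}(U)$ be the partition of $V$ into the vertex sets of the connected components of $G[U]$. -}

module Defs where

open import Data.Nat using (ℕ; zero; suc; _≤_; _<_; _*_)
open import Data.Nat.Primality using (Prime)
open import Data.Integer as ℤ using (ℤ; +_; -_)
open import Data.Integer.Divisibility using () renaming (_∣_ to _∣ℤ_)
open import Data.Fin using (Fin; zero; suc)
open import Data.Fin.Subset using (Subset; _∈_; _∉_; _⊆_; _∩_; ∣_∣; Nonempty)
open import Data.Bool using (Bool; true; false; if_then_else_)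
open import Data.Product using (Σ; ∃; ∃-syntax; _×_; _,_; proj₁; proj₂)
open import Data.Sum using (_⊎_)
open import Data.List using (List; []; _∷_)
open import Data.Vec using (lookup)
open import Data.List.Relation.Unary.Unique.Propositional using (Unique)
open import Data.Unit using (⊤)
open import Relation.Nullary using (¬_; Dec; yes; no)
open import Relation.Binary.PropositionalEquality using (_≡_; _≢_)
open import Data.Fin using (_≟_)
open import Function.Bundles using (_⇔_)

Ends : ℕ → ℕ → Set
Ends n m = Fin m → Fin n × Fin n

Simple : ∀ {n m} → Ends n m → Set
Simple {n} {m} ends =
  (∀ e → proj₁ (ends e) ≢ proj₂ (ends e)) ×
  (∀ e e' → (ends e ≡ ends e' ⊎
             (proj₁ (ends e) ≡ proj₂ (ends e') × proj₂ (ends e) ≡ proj₁ (ends e')))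
          → e ≡ e')

data Walk {n m} (ends : Ends n m) (P : Fin m → Set) : Fin n → Fin n → List (Fin m) → Set where
  nil  : ∀ {v} → Walk ends P v v []
  fwd  : ∀ {u w x es} e → P e → ends e ≡ (u , w) → Walk ends P w x es → Walk ends P u x (e ∷ es)
  bwd  : ∀ {u w x es} e → P e → ends e ≡ (w , u) → Walk ends P w x es → Walk ends P u x (e ∷ es)

Connected : ∀ {n m} → Ends n m → Set
Connected ends = ∀ u w → ∃[ es ] Walk ends (λ _ → ⊤) u w es

-- reachability in G[U] = (V , F)
Reach : ∀ {n m} → Ends n m → Subset m → Fin n → Fin n → Set
Reach ends F u w = ∃[ es ] Walk ends (_∈ F) u w es

IsComponent : ∀ {n m} → Ends n m → Subset m → Subset n → Set
IsComponent ends F Z = ∃[ v ] (∀ w → (w ∈ Z ⇔ Reach ends F v w))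

InducedEdge : ∀ {n m} → Ends n m → Subset m → Subset n → Fin m → Set
InducedEdge ends F Z e = e ∈ F × proj₁ (ends e) ∈ Z × proj₂ (ends e) ∈ Z

-- the subgraph of (V , F) induced by Z is a tree: non-empty, connected,
-- and acyclic (contains no closed trail of positive length, i.e. no cycle)
IsInducedTree : ∀ {n m} → Ends n m → Subset m → Subset n → Set
IsInducedTree ends F Z =
  Nonempty Z ×
  (∀ u w → u ∈ Z → w ∈ Z → ∃[ es ] Walk ends (InducedEdge ends F Z) u w es) ×
  (∀ v es → v ∈ Z → Walk ends (InducedEdge ends F Z) v v es → Unique es → es ≡ [])

IsPartition : ∀ {n s} → Subset n → (Fin s → Subset n) → Set
IsPartition {n} {s} T B =
  (∀ j → Nonempty (B j)) ×
  (∀ i j → i ≢ j → ∀ v → v ∈ B i → v ∉ B j) ×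
  (∀ v → (v ∈ T ⇔ (∃[ j ] v ∈ B j)))

LeastPrimeBetween : ℕ → ℕ → Set
LeastPrimeBetween s q =
  Prime q × s < q × q ≤ 2 * s ×
  (∀ p → Prime p → s < p → p ≤ 2 * s → q ≤ p)

-- F_q is modelled as ℤ modulo q: a ≐ b  means a = b in F_q
infix 4 _≐[_]_
_≐[_]_ : ℤ → ℕ → ℤ → Set
a ≐[ q ] b = (+ q) ∣ℤ (a ℤ.- b)

IsTheta : ∀ {n s} → ℕ → Subset n → (Fin s → Subset n) → (Fin n → ℤ) → Set
IsTheta q T B θ =
  ∀ t t' → t ∈ T → t' ∈ T → ((θ t ≐[ q ] θ t') ⇔ (∃[ j ] (t ∈ B j × t' ∈ B j)))

-- μ e : e → {1 , -1} is a bijection (values of μ e outside e are irrelevant)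
IsMu : ∀ {n m} → Ends n m → (Fin m → Fin n → ℤ) → Set
IsMu ends μ = ∀ e →
  (μ e (proj₁ (ends e)) ≡ + 1 × μ e (proj₂ (ends e)) ≡ - (+ 1)) ⊎
  (μ e (proj₁ (ends e)) ≡ - (+ 1) × μ e (proj₂ (ends e)) ≡ + 1)

-- W is embedded in F_q^(Fin n × Bool): the basis
-- vector t of a terminal is the coordinate (t , false), and for v ∉ T,
-- v° = (v , false), v• = (v , true).  Coordinates (t , true), t ∈ T,
-- are never used.

Vec' : ℕ → Set
Vec' n = Fin n × Bool → ℤ

δ : ∀ {n} → Fin n → Bool → Vec' n
δ v b (w , c) with v ≟ w
... | no _ = + 0
... | yes _ = if b then (if c then + 1 else + 0) else (if c then + 0 else + 1)

vertexO : ∀ {n} → Fin n → Vec' n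
vertexO v = δ v false

vertexB : ∀ {n} → Subset n → (Fin n → ℤ) → Fin n → Vec' n
vertexB T θ v x with lookup T v
... | true  = θ v ℤ.* δ v false x
... | false = δ v true x

edgeO : ∀ {n m} → Ends n m → (Fin m → Fin n → ℤ) → Fin m → Vec' n
edgeO ends μ e x =
  μ e (proj₁ (ends e)) ℤ.* vertexO (proj₁ (ends e)) x ℤ.+
  μ e (proj₂ (ends e)) ℤ.* vertexO (proj₂ (ends e)) x

edgeB : ∀ {n m} → Ends n m → Subset n → (Fin n → ℤ) → (Fin m → Fin n → ℤ) → Fin m → Vec' n
edgeB ends T θ μ e x =
  μ e (proj₁ (ends e)) ℤ.* vertexB T θ (proj₁ (ends e)) x ℤ.+
  μ e (proj₂ (ends e)) ℤ.* vertexB T θ (proj₂ (ends e)) x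

Σℤ : ∀ {k} → (Fin k → ℤ) → ℤ
Σℤ {zero}  f = + 0
Σℤ {suc k} f = f zero ℤ.+ Σℤ (λ i → f (suc i))

-- The feasible family U determined by S ⊆ T and F ⊆ E consists of the
-- vectors t (t ∈ S) and e°, e• (e ∈ F).
LinIndep : ∀ {n m} → ℕ → Ends n m → Subset n → (Fin n → ℤ) → (Fin m → Fin n → ℤ) →
           Subset n → Subset m → Set
LinIndep {n} {m} q ends T θ μ S F =
  (a : Fin n → ℤ) (bo bb : Fin m → ℤ) →
  (∀ t → t ∉ S → a t ≡ + 0) →
  (∀ e → e ∉ F → bo e ≡ + 0 × bb e ≡ + 0) →
  (∀ x → (Σℤ (λ t → a t ℤ.* vertexO t x) ℤ.+
          Σℤ (λ e → bo e ℤ.* edgeO ends μ e x) ℤ.+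
          Σℤ (λ e → bb e ℤ.* edgeB ends T θ μ e x)) ≐[ q ] + 0) →
  (∀ t → t ∈ S → a t ≐[ q ] + 0) ×
  (∀ e → e ∈ F → bo e ≐[ q ] + 0 × bb e ≐[ q ] + 0)

{-# OPTIONS --safe #-}
module Submission where

-- Write ° and • for the two kinds of basis vectors and let ∂b be the °-part of Σ b(e) e°.  For a
-- terminal t we have t• = θ(t) t, so W has no •-coordinate at t, and a relation Σ a(t) t +
-- Σ bᵒ(e) e° + Σ bᵇ(e) e• vanishes iff, at every non-terminal w, ∂bᵒ(w) = ∂bᵇ(w) = 0, and at
-- every terminal t, a(t) + ∂bᵒ(t) + θ(t) ∂bᵇ(t) = 0.
--
-- Only if: a walk from u to w contributes signed edge coefficients (its flow) that telescope to
-- u − w in both copies.  So a cycle gives a dependency among its e•, and so do two terminals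
-- t ≠ t′ joined by a walk with θ(t) = θ(t′), or a singleton s joined to another terminal t
-- (there, (θ t − θ s) s° is absorbed by the singleton s).  With three terminals in one component,
-- the two walks t₁ → t₂ and t₁ → t₃ force θ(t₁) = θ(t₃).
--
-- If: take an edge e = uv of U.  Deleting e from its component Z, which is a tree, leaves a side
-- A containing u and a side B containing v.  Summing ∂b over A gives ±b(e), as every other edge
-- of U either lies inside A or avoids it.  A side with no terminal forces bᵒ(e) = bᵇ(e) = 0.  If
-- both sides contain terminals then each side holds exactly one, t₁ and t₂, neither of them a
-- singleton, and bᵒ(e) + θ(tᵢ) bᵇ(e) = 0 for i = 1, 2; since θ(t₁) ≠ θ(t₂), both coefficients
-- vanish.  Last, once all edge coefficients vanish, a(t) = 0 at every singleton t.

open import Defs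
open import Data.Nat using (ℕ; zero; suc; s≤s; z≤n)
open import Data.Nat.Primality using (Prime)
open import Data.Integer using (ℤ; +_; -_)
open import Data.Bool using (true; false)
open import Data.Fin using (Fin; zero; suc; _≟_)
open import Data.Fin.Subset using (Subset; _∈_; _∉_; _⊆_; _∩_; Nonempty)
open import Data.Product using (∃-syntax; _×_; _,_; proj₁; proj₂)
open import Data.Sum using (_⊎_; inj₁; inj₂)
open import Data.Empty using (⊥)
open import Function using (_∘_; _$_)
open import Relation.Nullary using (¬_; Dec; yes; no; does; contradiction; ¬¬-excluded-middle)
open import Relation.Binary.PropositionalEquality

Sign : ℤ → Set
Sign k = k ≡ + 1 ⊎ k ≡ - + 1

module Sums where
  open import Data.Integer using (_+_; _*_)
  open import Data.Integer.Properties using (+-*-semiring; +-identityʳ; +-identityˡ; *-zeroˡ; *-zeroʳ; *-identityʳ)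
  open import Data.Fin.Properties using (suc-injective)
  open import Algebra.Properties.Semiring.Sum +-*-semiring public
    using (sum; sum-syntax; sum-cong-≗; ∑-distrib-+; ∑-comm; *-distribˡ-sum)

  Σℤ≡sum : ∀ {k} (f : Fin k → ℤ) → Σℤ f ≡ sum f
  Σℤ≡sum {zero}  f = refl
  Σℤ≡sum {suc k} f = cong (_+_ (f zero)) (Σℤ≡sum (f ∘ suc))

  sum-zero : ∀ {k} (f : Fin k → ℤ) → (∀ i → f i ≡ + 0) → sum f ≡ + 0
  sum-zero {zero}  f f≡0 = refl
  sum-zero {suc k} f f≡0 = cong₂ _+_ (f≡0 zero) (sum-zero (f ∘ suc) (f≡0 ∘ suc))

  sum-supported : ∀ {k} (f : Fin k → ℤ) j → (∀ i → i ≢ j → f i ≡ + 0) → sum f ≡ f j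
  sum-supported {suc k} f zero f≡0 =
    trans (cong (_+_ (f zero)) (sum-zero (f ∘ suc) (λ i → f≡0 (suc i) λ ()))) (+-identityʳ (f zero))
  sum-supported {suc k} f (suc j) f≡0 =
    trans (cong₂ _+_ (f≡0 zero λ ()) (sum-supported (f ∘ suc) j (λ i i≢j → f≡0 (suc i) (i≢j ∘ suc-injective))))
          (+-identityˡ (f (suc j)))

  indicator : ∀ {P : Set} → Dec P → ℤ
  indicator (yes _) = + 1
  indicator (no _)  = + 0

  indicator-yes : ∀ {P : Set} (P? : Dec P) → P → indicator P? ≡ + 1
  indicator-yes (yes _) _  = refl
  indicator-yes (no ¬p) p = contradiction p ¬p

  indicator-no : ∀ {P : Set} (P? : Dec P) → ¬ P → indicator P? ≡ + 0
  indicator-no (yes p) ¬p = contradiction p ¬p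
  indicator-no (no _)  _  = refl

  point : ∀ {k} → Fin k → ℤ → Fin k → ℤ
  point i c j = c * indicator (i ≟ j)

  point-self : ∀ {k} (i : Fin k) c → point i c i ≡ c
  point-self i c = trans (cong (c *_) (indicator-yes (i ≟ i) refl)) (*-identityʳ c)

  point-other : ∀ {k} {i j : Fin k} c → i ≢ j → point i c j ≡ + 0
  point-other {i = i} {j} c i≢j = trans (cong (c *_) (indicator-no (i ≟ j) i≢j)) (*-zeroʳ c)

  sum-point : ∀ {k} (i : Fin k) c (g : Fin k → ℤ) → sum (λ j → point i c j * g j) ≡ c * g i
  sum-point i c g =
    trans (sum-supported _ i (λ j j≢i → trans (cong (_* g j) (point-other c (j≢i ∘ sym))) (*-zeroˡ (g j))))
          (cong (_* g i) (point-self i c))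

module Modular (q : ℕ) where
  open import Data.Integer using (_+_; _-_; _*_)
  import Data.Integer as ℤ using (∣_∣)
  open import Data.Integer.Properties using (abs-*; *-identityʳ; *-comm; -1*i≡-i; neg-involutive; +-identityʳ)
  open import Data.Integer.Divisibility.Signed
    using (_∣_; divides; ∣ᵤ⇒∣; ∣⇒∣ᵤ; ∣m∣n⇒∣m+n; ∣m⇒∣-m; ∣m∣n⇒∣m-n; ∣n⇒∣m*n; ∣m+n∣n⇒∣m)
  import Data.Nat.Divisibility as ℕ using (_∣_; ∣1⇒≡1)
  open import Data.Nat.Primality using (euclidsLemma; ¬prime[1])
  open import Data.Integer.Tactic.RingSolver using (solve-∀)
  open Sums

  ∣0 : + q ∣ + 0
  ∣0 = divides (+ 0) refl

  ∣-sum : ∀ {k} (f : Fin k → ℤ) → (∀ i → + q ∣ f i) → + q ∣ sum f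
  ∣-sum {zero}  f q∣f = ∣0
  ∣-sum {suc k} f q∣f = ∣m∣n⇒∣m+n (q∣f zero) (∣-sum (f ∘ suc) (q∣f ∘ suc))

  ≐0⇒∣ : ∀ {a} → a ≐[ q ] + 0 → + q ∣ a
  ≐0⇒∣ {a} a≐0 = subst (+ q ∣_) (+-identityʳ a) (∣ᵤ⇒∣ a≐0)

  ∣⇒≐0 : ∀ {a} → + q ∣ a → a ≐[ q ] + 0
  ∣⇒≐0 {a} q∣a = ∣⇒∣ᵤ (subst (+ q ∣_) (sym (+-identityʳ a)) q∣a)

  ∣-cancel-sign : ∀ b {k} → Sign k → + q ∣ b * k → + q ∣ b
  ∣-cancel-sign b (inj₁ refl) q∣b*k = subst (+ q ∣_) (*-identityʳ b) q∣b*k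
  ∣-cancel-sign b (inj₂ refl) q∣b*k =
    subst (+ q ∣_) (neg-involutive b) (∣m⇒∣-m (subst (+ q ∣_) (trans (*-comm b (- + 1)) (-1*i≡-i b)) q∣b*k))

  module _ (q-prime : Prime q) where

    ∤sign : ∀ {k} → Sign k → ¬ (+ q ∣ k)
    ∤sign (inj₁ refl) q∣1  = ¬prime[1] (subst Prime (ℕ.∣1⇒≡1 (∣⇒∣ᵤ q∣1)) q-prime)
    ∤sign (inj₂ refl) q∣-1 = ∤sign (inj₁ refl) (∣m⇒∣-m q∣-1)

    ∣*-∤⇒∣ : ∀ x y → + q ∣ x * y → ¬ (+ q ∣ x) → + q ∣ y
    ∣*-∤⇒∣ x y q∣xy q∤x
      with euclidsLemma ℤ.∣ x ∣ ℤ.∣ y ∣ q-prime (subst (q ℕ.∣_) (abs-* x y) (∣⇒∣ᵤ q∣xy))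
    ... | inj₁ q∣x = contradiction (∣ᵤ⇒∣ q∣x) q∤x
    ... | inj₂ q∣y = ∣ᵤ⇒∣ q∣y

    ∣-linear-at-two-points : ∀ x y c₁ c₂ → ¬ (+ q ∣ c₁ - c₂) →
                             + q ∣ x + c₁ * y → + q ∣ x + c₂ * y → + q ∣ x × + q ∣ y
    ∣-linear-at-two-points x y c₁ c₂ q∤c₁-c₂ q∣at-c₁ q∣at-c₂ = q∣x , q∣y
      where
      difference : ∀ x y c₁ c₂ → (x + c₁ * y) - (x + c₂ * y) ≡ (c₁ - c₂) * y
      difference = solve-∀
      q∣y = ∣*-∤⇒∣ (c₁ - c₂) y (subst (+ q ∣_) (difference x y c₁ c₂) (∣m∣n⇒∣m-n q∣at-c₁ q∣at-c₂)) q∤c₁-c₂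
      q∣x = ∣m+n∣n⇒∣m q∣at-c₁ (∣n⇒∣m*n c₁ q∣y)

module Subsets where
  open import Data.Nat using (_≤_)
  open import Data.Nat.Properties using (≤-pred; ≤-trans)
  open import Data.Vec using (_∷_; tabulate; here; there)
  open import Data.Vec.Properties using ([]=⇒lookup; lookup⇒[]=; lookup∘tabulate)
  open import Data.Fin.Subset using (_-_; ⁅_⁆; ∣_∣)
  open import Data.Fin.Subset.Properties using (p─⊥≡p; p─q⊆p; x∈p∧x≢y⇒x∈p-y)
  open import Function.Bundles using (_⇔_; mk⇔)

  private variable
    k : ℕ
    p : Subset k
    x y : Fin k

  x∈p⇒∣p∣≡1+∣p-x∣ : x ∈ p → ∣ p ∣ ≡ suc ∣ p - x ∣
  x∈p⇒∣p∣≡1+∣p-x∣ {p = true ∷ p}  here        = cong suc (cong ∣_∣ (sym (p─⊥≡p p)))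
  x∈p⇒∣p∣≡1+∣p-x∣ {p = true ∷ p}  (there x∈p) = cong suc (x∈p⇒∣p∣≡1+∣p-x∣ x∈p)
  x∈p⇒∣p∣≡1+∣p-x∣ {p = false ∷ p} (there x∈p) = x∈p⇒∣p∣≡1+∣p-x∣ x∈p

  x∉p-x : x ∉ p - x
  x∉p-x {x = zero}  {p = _ ∷ _} ()
  x∉p-x {x = suc x} {p = _ ∷ _} (there x∈p-x) = x∉p-x x∈p-x

  y∈p-x⇒y≢x : y ∈ p - x → y ≢ x
  y∈p-x⇒y≢x y∈p-x refl = x∉p-x y∈p-x

  Distinct₂ Distinct₃ : Subset k → Set
  Distinct₂ p = ∃[ x ] ∃[ y ] (x ∈ p × y ∈ p × x ≢ y)
  Distinct₃ p = ∃[ x ] ∃[ y ] ∃[ z ] (x ∈ p × y ∈ p × z ∈ p × x ≢ y × x ≢ z × y ≢ z)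

  x∈p⇒1≤∣p∣ : x ∈ p → 1 ≤ ∣ p ∣
  x∈p⇒1≤∣p∣ x∈p rewrite x∈p⇒∣p∣≡1+∣p-x∣ x∈p = s≤s z≤n

  Distinct₂⇒2≤∣p∣ : Distinct₂ p → 2 ≤ ∣ p ∣
  Distinct₂⇒2≤∣p∣ (x , y , x∈p , y∈p , x≢y) rewrite x∈p⇒∣p∣≡1+∣p-x∣ x∈p =
    s≤s (x∈p⇒1≤∣p∣ (x∈p∧x≢y⇒x∈p-y y∈p (x≢y ∘ sym)))

  Distinct₃⇒3≤∣p∣ : Distinct₃ p → 3 ≤ ∣ p ∣
  Distinct₃⇒3≤∣p∣ (x , y , z , x∈p , y∈p , z∈p , x≢y , x≢z , y≢z) rewrite x∈p⇒∣p∣≡1+∣p-x∣ x∈p =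
    s≤s (Distinct₂⇒2≤∣p∣ (y , z , x∈p∧x≢y⇒x∈p-y y∈p (x≢y ∘ sym) , x∈p∧x≢y⇒x∈p-y z∈p (x≢z ∘ sym) , y≢z))

  1≤∣p∣⇒Nonempty : ∀ (p : Subset k) → 1 ≤ ∣ p ∣ → Nonempty p
  1≤∣p∣⇒Nonempty (true ∷ p)  _ = zero , here
  1≤∣p∣⇒Nonempty (false ∷ p) 1≤∣p∣ with 1≤∣p∣⇒Nonempty p 1≤∣p∣
  ... | x , x∈p = suc x , there x∈p

  2≤∣p∣⇒Distinct₂ : ∀ (p : Subset k) → 2 ≤ ∣ p ∣ → Distinct₂ p
  2≤∣p∣⇒Distinct₂ p 2≤∣p∣ with 1≤∣p∣⇒Nonempty p (≤-trans (s≤s z≤n) 2≤∣p∣)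
  ... | x , x∈p with 1≤∣p∣⇒Nonempty (p - x) (≤-pred (subst (2 ≤_) (x∈p⇒∣p∣≡1+∣p-x∣ x∈p) 2≤∣p∣))
  ...   | y , y∈p-x = x , y , x∈p , p─q⊆p p ⁅ x ⁆ y∈p-x , y∈p-x⇒y≢x y∈p-x ∘ sym

  3≤∣p∣⇒Distinct₃ : ∀ (p : Subset k) → 3 ≤ ∣ p ∣ → Distinct₃ p
  3≤∣p∣⇒Distinct₃ p 3≤∣p∣ with 1≤∣p∣⇒Nonempty p (≤-trans (s≤s z≤n) 3≤∣p∣)
  ... | x , x∈p with 2≤∣p∣⇒Distinct₂ (p - x) (≤-pred (subst (3 ≤_) (x∈p⇒∣p∣≡1+∣p-x∣ x∈p) 3≤∣p∣))
  ...   | y , z , y∈p-x , z∈p-x , y≢z =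
    x , y , z , x∈p , p─q⊆p p ⁅ x ⁆ y∈p-x , p─q⊆p p ⁅ x ⁆ z∈p-x ,
    y∈p-x⇒y≢x y∈p-x ∘ sym , y∈p-x⇒y≢x z∈p-x ∘ sym , y≢z

  subset : ∀ {Q : Fin k → Set} → (∀ i → Dec (Q i)) → Subset k
  subset Q? = tabulate (λ i → does (Q? i))

  ∈-subset : ∀ {Q : Fin k → Set} (Q? : ∀ i → Dec (Q i)) i → i ∈ subset Q? ⇔ Q i
  ∈-subset {Q = Q} Q? i = mk⇔ (λ i∈ → from-does (trans (sym (lookup∘tabulate _ i)) ([]=⇒lookup i∈)))
                              (λ Qi → lookup⇒[]= i _ (trans (lookup∘tabulate _ i) (to-does Qi)))
    where
    from-does : does (Q? i) ≡ true → Q i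
    from-does with Q? i
    ... | yes Qi = λ _ → Qi
    to-does : Q i → does (Q? i) ≡ true
    to-does Qi with Q? i
    ... | yes _  = refl
    ... | no ¬Qi = contradiction Qi ¬Qi

open Subsets using (Distinct₂; Distinct₃)

-- Reachability is not decided here; the double negation suffices because every goal that needs
-- it (divisibility of a coefficient by q) is decidable.
¬¬-decidable : ∀ {k} (Q : Fin k → Set) → ¬ ¬ (∀ i → Dec (Q i))
¬¬-decidable {zero}  Q ¬dec = ¬dec (λ ())
¬¬-decidable {suc k} Q ¬dec = ¬¬-excluded-middle λ Q0? →
  ¬¬-decidable (Q ∘ suc) λ Qsuc? → ¬dec λ { zero → Q0? ; (suc i) → Qsuc? i }

SeparatesTerminals : ∀ {n} → ℕ → Subset n → (Fin n → ℤ) → Subset n → Set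
SeparatesTerminals q T θ Z = ∀ {t t′} → t ∈ Z ∩ T → t′ ∈ Z ∩ T → t ≢ t′ → ¬ (θ t ≐[ q ] θ t′)

-- Conditions (a)-(c) on a component Z, with (b) and (c) phrased through distinct elements
-- instead of cardinalities.
Admissible : ∀ {n m} → ℕ → Ends n m → Subset n → (Fin n → ℤ) → Subset n → Subset m → Subset n → Set
Admissible q ends T θ S F Z =
  IsInducedTree ends F Z ×
  SeparatesTerminals q T θ Z ×
  ¬ Distinct₃ (Z ∩ T) ×
  (Nonempty (Z ∩ S) → ¬ Distinct₂ (Z ∩ T))

vertexO-self : ∀ {n} (w : Fin n) → vertexO w (w , false) ≡ + 1
vertexO-self w with w ≟ w
... | yes _   = refl
... | no w≢w = contradiction refl w≢w

vertexO-other : ∀ {n} {u w : Fin n} c → u ≢ w → vertexO u (w , c) ≡ + 0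
vertexO-other {u = u} {w} c u≢w with u ≟ w
... | yes u≡w = contradiction u≡w u≢w
... | no _    = refl

vertexO-true : ∀ {n} (u w : Fin n) → vertexO u (w , true) ≡ + 0
vertexO-true u w with u ≟ w
... | yes _ = refl
... | no _  = refl

vertexO-sym : ∀ {n} (u w : Fin n) → vertexO u (w , false) ≡ vertexO w (u , false)
vertexO-sym u w with u ≟ w | w ≟ u
... | yes _   | yes _   = refl
... | no _    | no _    = refl
... | yes u≡w | no w≢u  = contradiction (sym u≡w) w≢u
... | no u≢w  | yes w≡u = contradiction (sym w≡u) u≢w

module Walks {n m : ℕ} (ends : Ends n m) where
  open import Data.List using (List; []; _∷_; _++_)
  open import Data.List.Relation.Unary.All using (All; []; _∷_)
  open import Data.List.Relation.Unary.All.Properties using (¬Any⇒All¬)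
  open import Data.List.Relation.Unary.Any using (here; there)
  open import Data.List.Relation.Unary.AllPairs using ([]; _∷_)
  open import Data.List.Relation.Unary.Unique.Propositional using (Unique)
  open import Data.List.Membership.Propositional using () renaming (_∈_ to _∈ₗ_; _∉_ to _∉ₗ_)
  open import Data.List.Membership.DecPropositional (_≟_ {m}) using () renaming (_∈?_ to _∈ₗ?_)
  open import Data.Fin.Subset using (Subset; _∈_)
  open import Function.Bundles using (Equivalence)
  open Equivalence using (to; from)

  Reachable : (Fin m → Set) → Fin n → Fin n → Set
  Reachable P u w = ∃[ es ] Walk ends P u w es

  private variable
    P Q : Fin m → Set
    u w x y : Fin n
    e : Fin m
    es fs : List (Fin m)

  map-walk : (∀ {e} → P e → Q e) → Walk ends P u w es → Walk ends Q u w es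
  map-walk f nil                  = nil
  map-walk f (fwd e p ≡ends walk) = fwd e (f p) ≡ends (map-walk f walk)
  map-walk f (bwd e p ≡ends walk) = bwd e (f p) ≡ends (map-walk f walk)

  _++ʷ_ : Walk ends P u w es → Walk ends P w x fs → Walk ends P u x (es ++ fs)
  nil                ++ʷ walk′ = walk′
  fwd e p ≡ends walk ++ʷ walk′ = fwd e p ≡ends (walk ++ʷ walk′)
  bwd e p ≡ends walk ++ʷ walk′ = bwd e p ≡ends (walk ++ʷ walk′)

  walk-edges : Walk ends P u w es → All P es
  walk-edges nil              = []
  walk-edges (fwd e p _ walk) = p ∷ walk-edges walk
  walk-edges (bwd e p _ walk) = p ∷ walk-edges walk

  reach-refl : Reachable P u u
  reach-refl = [] , nil

  reach-trans : Reachable P u w → Reachable P w x → Reachable P u x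
  reach-trans (_ , walk) (_ , walk′) = _ , walk ++ʷ walk′

  reach-sym : Reachable P u w → Reachable P w u
  reach-sym (_ , nil)                = reach-refl
  reach-sym (_ , fwd e p ≡ends walk) = reach-trans (reach-sym (_ , walk)) (_ , bwd e p ≡ends nil)
  reach-sym (_ , bwd e p ≡ends walk) = reach-trans (reach-sym (_ , walk)) (_ , fwd e p ≡ends nil)

  reach-across : P e → Reachable P u (proj₁ (ends e)) → Reachable P u (proj₂ (ends e))
  reach-across {e = e} p reach = reach-trans reach (_ , fwd e p refl nil)

  reach-back : P e → Reachable P u (proj₂ (ends e)) → Reachable P u (proj₁ (ends e))
  reach-back {e = e} p reach = reach-trans reach (_ , bwd e p refl nil)

  avoids : Walk ends (λ e′ → P e′ × e′ ≢ e) u w es → e ∉ₗ es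
  avoids (fwd e′ (_ , e′≢e) _ walk) (here e≡e′) = e′≢e (sym e≡e′)
  avoids (bwd e′ (_ , e′≢e) _ walk) (here e≡e′) = e′≢e (sym e≡e′)
  avoids (fwd _ _ _ walk) (there e∈es) = avoids walk e∈es
  avoids (bwd _ _ _ walk) (there e∈es) = avoids walk e∈es

  Trail : (Fin m → Set) → Fin n → Fin n → Set
  Trail P u w = ∃[ es ] (Walk ends P u w es × Unique es)

  private
    trail-from-endpoint : Walk ends P x w es → Unique es → e ∈ₗ es →
                          proj₁ (ends e) ≡ y ⊎ proj₂ (ends e) ≡ y → Trail P y w
    trail-from-endpoint (fwd e p ≡ends walk) uniq       (here refl) (inj₁ refl) rewrite ≡ends =
      _ , fwd e p ≡ends walk , uniq
    trail-from-endpoint (fwd e p ≡ends walk) (_ ∷ uniq) (here refl) (inj₂ refl) rewrite ≡ends = _ , walk , uniq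
    trail-from-endpoint (bwd e p ≡ends walk) (_ ∷ uniq) (here refl) (inj₁ refl) rewrite ≡ends = _ , walk , uniq
    trail-from-endpoint (bwd e p ≡ends walk) uniq       (here refl) (inj₂ refl) rewrite ≡ends =
      _ , bwd e p ≡ends walk , uniq
    trail-from-endpoint (fwd _ _ _ walk) (_ ∷ uniq) (there e∈es) = trail-from-endpoint walk uniq e∈es
    trail-from-endpoint (bwd _ _ _ walk) (_ ∷ uniq) (there e∈es) = trail-from-endpoint walk uniq e∈es

  walk⇒trail : Walk ends P u w es → Trail P u w
  walk⇒trail nil = _ , nil , []
  walk⇒trail (fwd e p ≡ends walk) with walk⇒trail walk
  ... | es′ , trail , uniq with e ∈ₗ? es′
  ...   | yes e∈es′ = trail-from-endpoint trail uniq e∈es′ (inj₁ (cong proj₁ ≡ends))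
  ...   | no e∉es′ = _ , fwd e p ≡ends trail , ¬Any⇒All¬ es′ e∉es′ ∷ uniq
  walk⇒trail (bwd e p ≡ends walk) with walk⇒trail walk
  ... | es′ , trail , uniq with e ∈ₗ? es′
  ...   | yes e∈es′ = trail-from-endpoint trail uniq e∈es′ (inj₂ (cong proj₂ ≡ends))
  ...   | no e∉es′ = _ , bwd e p ≡ends trail , ¬Any⇒All¬ es′ e∉es′ ∷ uniq

  module _ {F : Subset m} {Z : Subset n} where

    component-closed : IsComponent ends F Z → x ∈ Z → Reach ends F x y → y ∈ Z
    component-closed (r , Z⇔reach) x∈Z reach = from (Z⇔reach _) (reach-trans (to (Z⇔reach _) x∈Z) reach)

    component-connected : IsComponent ends F Z → x ∈ Z → y ∈ Z → Reach ends F x y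
    component-connected (r , Z⇔reach) x∈Z y∈Z =
      reach-trans (reach-sym (to (Z⇔reach _) x∈Z)) (to (Z⇔reach _) y∈Z)

    private
      both-in : ends e ≡ (u , w) → u ∈ Z → w ∈ Z → proj₁ (ends e) ∈ Z × proj₂ (ends e) ∈ Z
      both-in ≡ends u∈Z w∈Z rewrite ≡ends = u∈Z , w∈Z

    induced-walk : (∀ {x y} → x ∈ Z → Reach ends F x y → y ∈ Z) →
                   u ∈ Z → Walk ends (_∈ F) u w es → Walk ends (InducedEdge ends F Z) u w es
    induced-walk closed u∈Z nil = nil
    induced-walk closed u∈Z (fwd e e∈F ≡ends walk) =
      fwd e (e∈F , both-in ≡ends u∈Z w∈Z) ≡ends (induced-walk closed w∈Z walk)
      where w∈Z = closed u∈Z (_ , fwd e e∈F ≡ends nil)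
    induced-walk closed u∈Z (bwd e e∈F ≡ends walk) =
      bwd e (e∈F , both-in ≡ends w∈Z u∈Z) ≡ends (induced-walk closed w∈Z walk)
      where w∈Z = closed u∈Z (_ , bwd e e∈F ≡ends nil)

module Flows {n m : ℕ} (ends : Ends n m) (μ : Fin m → Fin n → ℤ) (μ-signs : IsMu ends μ) where
  open import Data.Integer using (_+_; _-_; _*_)
  open import Data.Integer.Properties
    using (*-zeroˡ; *-zeroʳ; *-identityˡ; *-identityʳ; +-identityʳ; +-comm; +-inverseʳ; *-distribʳ-+)
  open import Data.Integer.Tactic.RingSolver using (solve-∀)
  open import Data.List using (List; _∷_)
  open import Data.List.Relation.Unary.All as All using (All)
  open import Data.List.Relation.Unary.Any using (here; there)
  open import Data.List.Membership.Propositional using () renaming (_∉_ to _∉ₗ_)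
  open Sums
  open Walks ends

  private variable
    P : Fin m → Set
    u w y : Fin n
    e : Fin m
    es : List (Fin m)

  Endpoints : Fin m → Fin n → Fin n → Set
  Endpoints e u w = ends e ≡ (u , w) ⊎ ends e ≡ (w , u)

  μ-opposite : Endpoints e u w → Sign (μ e u) × μ e w ≡ - μ e u
  μ-opposite {e} (inj₁ refl) with μ-signs e
  ... | inj₁ (μu≡1 , μw≡-1) rewrite μu≡1 | μw≡-1 = inj₁ refl , refl
  ... | inj₂ (μu≡-1 , μw≡1) rewrite μu≡-1 | μw≡1 = inj₂ refl , refl
  μ-opposite {e} (inj₂ refl) with μ-signs e
  ... | inj₁ (μw≡1 , μu≡-1) rewrite μu≡-1 | μw≡1 = inj₂ refl , refl
  ... | inj₂ (μw≡-1 , μu≡1) rewrite μu≡1 | μw≡-1 = inj₁ refl , refl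

  private
    sign-squared : ∀ {k} → Sign k → k * k ≡ + 1
    sign-squared (inj₁ refl) = refl
    sign-squared (inj₂ refl) = refl

    sign-cancels : ∀ {k} → Sign k → ∀ a b → k * (k * a + - k * b) ≡ a - b
    sign-cancels {k} k-sign a b = begin
      k * (k * a + - k * b) ≡⟨ expand k a b ⟩
      (k * k) * (a - b)     ≡⟨ cong (_* (a - b)) (sign-squared k-sign) ⟩
      + 1 * (a - b)         ≡⟨ *-identityˡ (a - b) ⟩
      a - b                 ∎
      where
      open ≡-Reasoning
      expand : ∀ k a b → k * (k * a + - k * b) ≡ (k * k) * (a - b)
      expand = solve-∀

  edgeVector : (Fin n → Vec' n) → Fin m → Vec' n
  edgeVector f e x =
    μ e (proj₁ (ends e)) * f (proj₁ (ends e)) x + μ e (proj₂ (ends e)) * f (proj₂ (ends e)) x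

  edgeVector-endpoints : ∀ f x → Endpoints e u w → edgeVector f e x ≡ μ e u * f u x + μ e w * f w x
  edgeVector-endpoints f x (inj₁ ≡ends) rewrite ≡ends = refl
  edgeVector-endpoints {e} {u} {w} f x (inj₂ ≡ends) rewrite ≡ends =
    +-comm (μ e w * f w x) (μ e u * f u x)

  traverse : ∀ f x → Endpoints e u w → μ e u * edgeVector f e x ≡ f u x - f w x
  traverse {e} {u} {w} f x endpoints with μ-opposite endpoints
  ... | μu-sign , μw≡-μu rewrite edgeVector-endpoints f x endpoints | μw≡-μu =
    sign-cancels μu-sign (f u x) (f w x)

  flow : Walk ends P u w es → Fin m → ℤ
  flow nil                      e′ = + 0
  flow (fwd {u = u} e _ _ walk) e′ = point e (μ e u) e′ + flow walk e′
  flow (bwd {u = u} e _ _ walk) e′ = point e (μ e u) e′ + flow walk e′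

  private
    telescope-step : ∀ f x → Endpoints e u w → (walk : Walk ends P w y es) →
      sum (λ e′ → (point e (μ e u) e′ + flow walk e′) * edgeVector f e′ x) ≡ f u x - f y x

  flow-telescopes : ∀ f x (walk : Walk ends P u w es) →
                    sum (λ e → flow walk e * edgeVector f e x) ≡ f u x - f w x
  flow-telescopes {u = u} f x nil =
    trans (sum-zero (λ e → + 0 * edgeVector f e x) (λ e → *-zeroˡ (edgeVector f e x)))
          (sym (+-inverseʳ (f u x)))
  flow-telescopes f x (fwd e _ ≡ends walk) = telescope-step f x (inj₁ ≡ends) walk
  flow-telescopes f x (bwd e _ ≡ends walk) = telescope-step f x (inj₂ ≡ends) walk

  telescope-step {e} {u} {w} {y = y} f x endpoints walk = begin
    sum (λ e′ → (point e (μ e u) e′ + flow walk e′) * g e′)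
      ≡⟨ sum-cong-≗ (λ e′ → *-distribʳ-+ (g e′) (point e (μ e u) e′) (flow walk e′)) ⟩
    sum (λ e′ → point e (μ e u) e′ * g e′ + flow walk e′ * g e′)
      ≡⟨ ∑-distrib-+ (λ e′ → point e (μ e u) e′ * g e′) (λ e′ → flow walk e′ * g e′) ⟩
    sum (λ e′ → point e (μ e u) e′ * g e′) + sum (λ e′ → flow walk e′ * g e′)
      ≡⟨ cong₂ _+_ (sum-point e (μ e u) g) (flow-telescopes f x walk) ⟩
    μ e u * g e + (f w x - f y x)
      ≡⟨ cong (_+ (f w x - f y x)) (traverse f x endpoints) ⟩
    (f u x - f w x) + (f w x - f y x)
      ≡⟨ telescope (f u x) (f w x) (f y x) ⟩
    f u x - f y x ∎
    where
    open ≡-Reasoning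
    g = λ e′ → edgeVector f e′ x
    telescope : ∀ a b c → (a - b) + (b - c) ≡ a - c
    telescope = solve-∀

  flow-∉ : (walk : Walk ends P u w es) → e ∉ₗ es → flow walk e ≡ + 0
  flow-∉ nil e∉es = refl
  flow-∉ (fwd {u = u} e′ _ _ walk) e∉es =
    cong₂ _+_ (point-other (μ e′ u) (e∉es ∘ here ∘ sym)) (flow-∉ walk (e∉es ∘ there))
  flow-∉ (bwd {u = u} e′ _ _ walk) e∉es =
    cong₂ _+_ (point-other (μ e′ u) (e∉es ∘ here ∘ sym)) (flow-∉ walk (e∉es ∘ there))

  flow-outside : ∀ {F : Subset m} (walk : Walk ends (_∈ F) u w es) → e ∉ F → flow walk e ≡ + 0
  flow-outside walk e∉F = flow-∉ walk (e∉F ∘ All.lookup (walk-edges walk))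

  first-edge-sign : Walk ends P u w (e ∷ es) → Sign (μ e u)
  first-edge-sign (fwd e _ ≡ends _) = proj₁ (μ-opposite (inj₁ ≡ends))
  first-edge-sign (bwd e _ ≡ends _) = proj₁ (μ-opposite (inj₂ ≡ends))

  first-edge-flow : (walk : Walk ends P u w (e ∷ es)) → e ∉ₗ es → flow walk e ≡ μ e u
  first-edge-flow {u = u} (fwd e _ _ rest) e∉es =
    trans (cong₂ _+_ (point-self e (μ e u)) (flow-∉ rest e∉es)) (+-identityʳ (μ e u))
  first-edge-flow {u = u} (bwd e _ _ rest) e∉es =
    trans (cong₂ _+_ (point-self e (μ e u)) (flow-∉ rest e∉es)) (+-identityʳ (μ e u))

  ∂ : (Fin m → ℤ) → Fin n → ℤ
  ∂ b w = ∑[ e < m ] (b e * edgeVector vertexO e (w , false))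

  coboundary : (Fin n → ℤ) → Fin m → ℤ
  coboundary χ e =
    μ e (proj₁ (ends e)) * χ (proj₁ (ends e)) + μ e (proj₂ (ends e)) * χ (proj₂ (ends e))

  coboundary-constant : ∀ χ e → χ (proj₁ (ends e)) ≡ χ (proj₂ (ends e)) → coboundary χ e ≡ + 0
  coboundary-constant χ e χ₁≡χ₂ rewrite χ₁≡χ₂ | proj₂ (μ-opposite {e} (inj₁ refl)) =
    cancel (μ e (proj₁ (ends e))) (χ (proj₂ (ends e)))
    where
    cancel : ∀ k a → k * a + - k * a ≡ + 0
    cancel = solve-∀

  ∂-linear : ∀ b₁ b₂ c w → ∂ (λ e → b₁ e + c * b₂ e) w ≡ ∂ b₁ w + c * ∂ b₂ w
  ∂-linear b₁ b₂ c w = begin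
    ∑[ e < m ] ((b₁ e + c * b₂ e) * g e)
      ≡⟨ sum-cong-≗ (λ e → distribute (b₁ e) c (b₂ e) (g e)) ⟩
    ∑[ e < m ] (b₁ e * g e + c * (b₂ e * g e))
      ≡⟨ ∑-distrib-+ (λ e → b₁ e * g e) (λ e → c * (b₂ e * g e)) ⟩
    ∂ b₁ w + ∑[ e < m ] (c * (b₂ e * g e))
      ≡⟨ cong (_+_ (∂ b₁ w)) (*-distribˡ-sum c (λ e → b₂ e * g e)) ⟨
    ∂ b₁ w + c * ∂ b₂ w ∎
    where
    open ≡-Reasoning
    g = λ e → edgeVector vertexO e (w , false)
    distribute : ∀ x c y z → (x + c * y) * z ≡ x * z + c * (y * z)
    distribute = solve-∀

  coboundary-endpoints : ∀ χ → Endpoints e u w → coboundary χ e ≡ μ e u * χ u + μ e w * χ w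
  coboundary-endpoints χ (inj₁ ≡ends) rewrite ≡ends = refl
  coboundary-endpoints {e} {u} {w} χ (inj₂ ≡ends) rewrite ≡ends =
    +-comm (μ e w * χ w) (μ e u * χ u)

  pairing-vertex : ∀ (χ : Fin n → ℤ) p → ∑[ w < n ] (χ w * vertexO p (w , false)) ≡ χ p
  pairing-vertex χ p = begin
    ∑[ w < n ] (χ w * vertexO p (w , false))
      ≡⟨ sum-supported _ p (λ w w≢p → trans (cong (χ w *_) (vertexO-other false (w≢p ∘ sym)))
                                            (*-zeroʳ (χ w))) ⟩
    χ p * vertexO p (p , false) ≡⟨ cong (χ p *_) (vertexO-self p) ⟩
    χ p * + 1                   ≡⟨ *-identityʳ (χ p) ⟩
    χ p                         ∎
    where open ≡-Reasoning

  private
    pairing-edge : ∀ (χ : Fin n → ℤ) e → ∑[ w < n ] (χ w * edgeVector vertexO e (w , false)) ≡ coboundary χ e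
    pairing-edge χ e = begin
      ∑[ w < n ] (χ w * (μ₁ * o₁ w + μ₂ * o₂ w))
        ≡⟨ sum-cong-≗ (λ w → distribute (χ w) μ₁ μ₂ (o₁ w) (o₂ w)) ⟩
      ∑[ w < n ] (μ₁ * (χ w * o₁ w) + μ₂ * (χ w * o₂ w))
        ≡⟨ ∑-distrib-+ (λ w → μ₁ * (χ w * o₁ w)) (λ w → μ₂ * (χ w * o₂ w)) ⟩
      ∑[ w < n ] (μ₁ * (χ w * o₁ w)) + ∑[ w < n ] (μ₂ * (χ w * o₂ w))
        ≡⟨ cong₂ _+_ (*-distribˡ-sum μ₁ (λ w → χ w * o₁ w)) (*-distribˡ-sum μ₂ (λ w → χ w * o₂ w)) ⟨
      μ₁ * ∑[ w < n ] (χ w * o₁ w) + μ₂ * ∑[ w < n ] (χ w * o₂ w)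
        ≡⟨ cong₂ (λ a b → μ₁ * a + μ₂ * b) (pairing-vertex χ p₁) (pairing-vertex χ p₂) ⟩
      coboundary χ e ∎
      where
      open ≡-Reasoning
      p₁ = proj₁ (ends e)
      p₂ = proj₂ (ends e)
      μ₁ = μ e p₁
      μ₂ = μ e p₂
      o₁ o₂ : Fin n → ℤ
      o₁ w = vertexO p₁ (w , false)
      o₂ w = vertexO p₂ (w , false)
      distribute : ∀ c k₁ k₂ a b → c * (k₁ * a + k₂ * b) ≡ k₁ * (c * a) + k₂ * (c * b)
      distribute = solve-∀

  ∂-adjoint : ∀ (χ : Fin n → ℤ) b → ∑[ w < n ] (χ w * ∂ b w) ≡ ∑[ e < m ] (b e * coboundary χ e)
  ∂-adjoint χ b = begin
    ∑[ w < n ] (χ w * ∂ b w)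
      ≡⟨ sum-cong-≗ (λ w → *-distribˡ-sum (χ w) (λ e → b e * g e w)) ⟩
    ∑[ w < n ] ∑[ e < m ] (χ w * (b e * g e w))
      ≡⟨ ∑-comm (λ w e → χ w * (b e * g e w)) ⟩
    ∑[ e < m ] ∑[ w < n ] (χ w * (b e * g e w))
      ≡⟨ sum-cong-≗ (λ e → sum-cong-≗ (λ w → swap (χ w) (b e) (g e w))) ⟩
    ∑[ e < m ] ∑[ w < n ] (b e * (χ w * g e w))
      ≡⟨ sum-cong-≗ (λ e → *-distribˡ-sum (b e) (λ w → χ w * g e w)) ⟨
    ∑[ e < m ] (b e * ∑[ w < n ] (χ w * g e w))
      ≡⟨ sum-cong-≗ (λ e → cong (b e *_) (pairing-edge χ e)) ⟩
    ∑[ e < m ] (b e * coboundary χ e) ∎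
    where
    open ≡-Reasoning
    g = λ e w → edgeVector vertexO e (w , false)
    swap : ∀ a b c → a * (b * c) ≡ b * (a * c)
    swap = solve-∀

module Coordinates {n m : ℕ} (ends : Ends n m) (μ : Fin m → Fin n → ℤ) (μ-signs : IsMu ends μ)
                   (T : Subset n) (θ : Fin n → ℤ) where
  open import Data.Integer using (_+_; _*_)
  open import Data.Integer.Properties using (*-zeroʳ; +-identityˡ)
  open import Data.Integer.Tactic.RingSolver using (solve-∀)
  open import Data.Bool using (Bool; if_then_else_)
  open import Data.Vec using (lookup)
  open import Data.Vec.Properties using ([]=⇒lookup)
  open Sums
  open Flows ends μ μ-signs

  vertexB-terminal : ∀ {t} x → t ∈ T → vertexB T θ t x ≡ θ t * vertexO t x
  vertexB-terminal {t} x t∈T with lookup T t | []=⇒lookup t∈T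
  ... | true | refl = refl

  bulletFactor : Bool → Fin n → ℤ
  bulletFactor false w = if lookup T w then θ w else + 0
  bulletFactor true  w = if lookup T w then + 0 else + 1

  private
    vertexB-other : ∀ {p w} c → p ≢ w → vertexB T θ p (w , c) ≡ + 0
    vertexB-other {p} {w} c p≢w with lookup T p
    ... | true  = trans (cong (θ p *_) (vertexO-other c p≢w)) (*-zeroʳ (θ p))
    ... | false with p ≟ w
    ...   | yes p≡w = contradiction p≡w p≢w
    ...   | no _    = refl

    δ-true-false : ∀ (p w : Fin n) → δ p true (w , false) ≡ + 0
    δ-true-false p w with p ≟ w
    ... | yes _ = refl
    ... | no _  = refl

    δ-true-self : ∀ (p : Fin n) → δ p true (p , true) ≡ + 1
    δ-true-self p with p ≟ p
    ... | yes _   = refl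
    ... | no p≢p = contradiction refl p≢p

    vertexB-self : ∀ p c → vertexB T θ p (p , c) ≡ bulletFactor c p * vertexO p (p , false)
    vertexB-self p false with lookup T p
    ... | true  = refl
    ... | false = δ-true-false p p
    vertexB-self p true with lookup T p
    ... | true  = trans (cong (θ p *_) (vertexO-true p p)) (*-zeroʳ (θ p))
    ... | false = trans (δ-true-self p) (cong (+ 1 *_) (sym (vertexO-self p)))

  vertexB-coordinate : ∀ p w c → vertexB T θ p (w , c) ≡ bulletFactor c w * vertexO p (w , false)
  vertexB-coordinate p w c = by-cases (p ≟ w)
    where
    by-cases : Dec (p ≡ w) → vertexB T θ p (w , c) ≡ bulletFactor c w * vertexO p (w , false)
    by-cases (yes refl) = vertexB-self p c
    by-cases (no p≢w)   = trans (vertexB-other c p≢w)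
      (sym (trans (cong (bulletFactor c w *_) (vertexO-other false p≢w)) (*-zeroʳ (bulletFactor c w))))

  combination : (Fin n → ℤ) → (Fin m → ℤ) → (Fin m → ℤ) → Vec' n
  combination a bo bb x = ∑[ t < n ] (a t * vertexO t x) + ∑[ e < m ] (bo e * edgeO ends μ e x)
                                                          + ∑[ e < m ] (bb e * edgeB ends T θ μ e x)

  Σℤ≡combination : ∀ a bo bb x →
    Σℤ (λ t → a t * vertexO t x) + Σℤ (λ e → bo e * edgeO ends μ e x) + Σℤ (λ e → bb e * edgeB ends T θ μ e x)
      ≡ combination a bo bb x
  Σℤ≡combination a bo bb x =
    cong₂ _+_ (cong₂ _+_ (Σℤ≡sum (λ t → a t * vertexO t x)) (Σℤ≡sum (λ e → bo e * edgeO ends μ e x)))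
              (Σℤ≡sum (λ e → bb e * edgeB ends T θ μ e x))

  private
    edges-at-vertex : ∀ f (b : Fin m → ℤ) c w x → (∀ p → f p x ≡ c * vertexO p (w , false)) →
                      ∑[ e < m ] (b e * edgeVector f e x) ≡ c * ∂ b w
    edges-at-vertex f b c w x f≡c*vertexO = begin
      ∑[ e < m ] (b e * edgeVector f e x)  ≡⟨ sum-cong-≗ (λ e → cong (b e *_) (scale e)) ⟩
      ∑[ e < m ] (b e * (c * g e))         ≡⟨ sum-cong-≗ (λ e → swap (b e) c (g e)) ⟩
      ∑[ e < m ] (c * (b e * g e))         ≡⟨ *-distribˡ-sum c (λ e → b e * g e) ⟨
      c * ∂ b w                            ∎
      where
      open ≡-Reasoning
      swap : ∀ a b c → a * (b * c) ≡ b * (a * c)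
      swap = solve-∀
      pull : ∀ k₁ k₂ c a₁ a₂ → k₁ * (c * a₁) + k₂ * (c * a₂) ≡ c * (k₁ * a₁ + k₂ * a₂)
      pull = solve-∀
      g = λ e → edgeVector vertexO e (w , false)
      scale : ∀ e → edgeVector f e x ≡ c * g e
      scale e rewrite f≡c*vertexO (proj₁ (ends e)) | f≡c*vertexO (proj₂ (ends e)) =
        pull (μ e (proj₁ (ends e))) (μ e (proj₂ (ends e))) c _ _

  combination-false : ∀ a bo bb w →
                      combination a bo bb (w , false) ≡ a w + ∂ bo w + bulletFactor false w * ∂ bb w
  combination-false a bo bb w = cong₂ _+_
    (cong (_+ ∂ bo w) (trans (sum-cong-≗ (λ t → cong (a t *_) (vertexO-sym t w))) (pairing-vertex a w)))
    (edges-at-vertex (vertexB T θ) bb (bulletFactor false w) w (w , false) (λ p → vertexB-coordinate p w false))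

  combination-true : ∀ a bo bb w → combination a bo bb (w , true) ≡ bulletFactor true w * ∂ bb w
  combination-true a bo bb w = begin
    combination a bo bb (w , true)
      ≡⟨ cong₂ _+_
           (cong₂ _+_ (sum-zero _ (λ t → trans (cong (a t *_) (vertexO-true t w)) (*-zeroʳ (a t))))
                      (edges-at-vertex vertexO bo (+ 0) w (w , true) (λ p → vertexO-true p w)))
           (edges-at-vertex (vertexB T θ) bb (bulletFactor true w) w (w , true) (λ p → vertexB-coordinate p w true)) ⟩
    + 0 + + 0 * ∂ bo w + bulletFactor true w * ∂ bb w ≡⟨ +-identityˡ _ ⟩
    bulletFactor true w * ∂ bb w ∎
    where open ≡-Reasoning


module Forward {n m q : ℕ} (ends : Ends n m) (μ : Fin m → Fin n → ℤ) (μ-signs : IsMu ends μ)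
               (T : Subset n) (θ : Fin n → ℤ) (S : Subset n) (S⊆T : S ⊆ T) (F : Subset m)
               (q-prime : Prime q) (independent : LinIndep q ends T θ μ S F) where
  open import Data.Integer using (_+_; _-_; _*_)
  open import Data.Integer.Properties using (*-zeroˡ; *-zeroʳ; *-identityˡ; +-identityʳ; neg-involutive)
  open import Data.Integer.Divisibility.Signed using (_∣_; ∣ᵤ⇒∣; ∣⇒∣ᵤ; ∣m⇒∣m*n; ∣n⇒∣m*n; ∣m⇒∣-m)
  open import Data.Integer.Tactic.RingSolver using (solve-∀)
  open import Data.Fin.Subset.Properties using (_∈?_; x∈p∩q⁺; x∈p∩q⁻)
  open import Data.List using ([]; _∷_)
  open import Data.List.Relation.Unary.All using (_∷_)
  open import Data.List.Relation.Unary.All.Properties using (All¬⇒¬Any)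
  open import Data.List.Relation.Unary.AllPairs using (_∷_)
  open import Data.List.Relation.Unary.Unique.Propositional using (Unique)
  open import Function.Bundles using (Equivalence)
  open Sums
  open Modular q
  open Walks ends
  open Flows ends μ μ-signs
  open Coordinates ends μ μ-signs T θ

  module TwoWalks {r t₁ t₂ es₁ es₂} (W₁ : Walk ends (_∈ F) r t₁ es₁) (W₂ : Walk ends (_∈ F) r t₂ es₂) where

    flows : ℤ → ℤ → Fin m → ℤ
    flows c₁ c₂ e = c₁ * flow W₁ e + c₂ * flow W₂ e

    telescoped : (Fin n → Vec' n) → ℤ → ℤ → Vec' n
    telescoped f c₁ c₂ x = c₁ * (f r x - f t₁ x) + c₂ * (f r x - f t₂ x)

    flows-telescope : ∀ c₁ c₂ f x → ∑[ e < m ] (flows c₁ c₂ e * edgeVector f e x) ≡ telescoped f c₁ c₂ x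
    flows-telescope c₁ c₂ f x = begin
      ∑[ e < m ] ((c₁ * flow W₁ e + c₂ * flow W₂ e) * g e)
        ≡⟨ sum-cong-≗ (λ e → distribute c₁ c₂ (flow W₁ e) (flow W₂ e) (g e)) ⟩
      ∑[ e < m ] (c₁ * (flow W₁ e * g e) + c₂ * (flow W₂ e * g e))
        ≡⟨ ∑-distrib-+ (λ e → c₁ * (flow W₁ e * g e)) (λ e → c₂ * (flow W₂ e * g e)) ⟩
      ∑[ e < m ] (c₁ * (flow W₁ e * g e)) + ∑[ e < m ] (c₂ * (flow W₂ e * g e))
        ≡⟨ cong₂ _+_ (*-distribˡ-sum c₁ (λ e → flow W₁ e * g e)) (*-distribˡ-sum c₂ (λ e → flow W₂ e * g e)) ⟨
      c₁ * ∑[ e < m ] (flow W₁ e * g e) + c₂ * ∑[ e < m ] (flow W₂ e * g e)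
        ≡⟨ cong₂ (λ a b → c₁ * a + c₂ * b) (flow-telescopes f x W₁) (flow-telescopes f x W₂) ⟩
      telescoped f c₁ c₂ x ∎
      where
      open ≡-Reasoning
      g = λ e → edgeVector f e x
      distribute : ∀ c₁ c₂ a₁ a₂ b → (c₁ * a₁ + c₂ * a₂) * b ≡ c₁ * (a₁ * b) + c₂ * (a₂ * b)
      distribute = solve-∀

    flows-outside : ∀ c₁ c₂ {e} → e ∉ F → flows c₁ c₂ e ≡ + 0
    flows-outside c₁ c₂ e∉F rewrite flow-outside W₁ e∉F | flow-outside W₂ e∉F = cong₂ _+_ (*-zeroʳ c₁) (*-zeroʳ c₂)

    telescoped-at-terminals : r ∈ T → t₁ ∈ T → t₂ ∈ T → ∀ c₁ c₂ x →
      telescoped (vertexB T θ) c₁ c₂ x ≡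
      c₁ * (θ r * vertexO r x - θ t₁ * vertexO t₁ x) + c₂ * (θ r * vertexO r x - θ t₂ * vertexO t₂ x)
    telescoped-at-terminals r∈T t₁∈T t₂∈T c₁ c₂ x
      rewrite vertexB-terminal x r∈T | vertexB-terminal x t₁∈T | vertexB-terminal x t₂∈T = refl

    Relation : (Fin n → ℤ) → ℤ → ℤ → ℤ → ℤ → Set
    Relation a α₁ α₂ β₁ β₂ =
      ∀ x → + q ∣ ∑[ t < n ] (a t * vertexO t x) + telescoped vertexO α₁ α₂ x + telescoped (vertexB T θ) β₁ β₂ x

    module _ (a : Fin n → ℤ) (a-outside : ∀ t → t ∉ S → a t ≡ + 0) (α₁ α₂ β₁ β₂ : ℤ)
             (relation : Relation a α₁ α₂ β₁ β₂) where

      β-flows-vanish : ∀ e → e ∈ F → + q ∣ flows β₁ β₂ e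
      β-flows-vanish e e∈F = ≐0⇒∣ (proj₂ (proj₂ coefficients-vanish e e∈F))
        where
        bᵒ = flows α₁ α₂
        bᵇ = flows β₁ β₂
        combination≡relation : ∀ x → combination a bᵒ bᵇ x ≡
          ∑[ t < n ] (a t * vertexO t x) + telescoped vertexO α₁ α₂ x + telescoped (vertexB T θ) β₁ β₂ x
        combination≡relation x =
          cong₂ _+_ (cong (_+_ (∑[ t < n ] (a t * vertexO t x))) (flows-telescope α₁ α₂ vertexO x))
                    (flows-telescope β₁ β₂ (vertexB T θ) x)
        coefficients-vanish = independent a bᵒ bᵇ a-outside
          (λ e e∉F → flows-outside α₁ α₂ e∉F , flows-outside β₁ β₂ e∉F)
          (λ x → ∣⇒≐0 (subst (+ q ∣_) (sym (trans (Σℤ≡combination a bᵒ bᵇ x) (combination≡relation x))) (relation x)))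

      β-telescoped-vanishes : ∀ x → + q ∣ telescoped vertexO β₁ β₂ x
      β-telescoped-vanishes x = subst (+ q ∣_) (flows-telescope β₁ β₂ vertexO x) (∣-sum _ term-vanishes)
        where
        term-vanishes : ∀ e → + q ∣ flows β₁ β₂ e * edgeVector vertexO e x
        term-vanishes e with e ∈? F
        ... | yes e∈F = ∣m⇒∣m*n _ (β-flows-vanish e e∈F)
        ... | no e∉F  = subst (+ q ∣_) (sym (trans (cong (_* g) (flows-outside β₁ β₂ e∉F)) (*-zeroˡ g))) ∣0
          where g = edgeVector vertexO e x

  no-singletons : ∀ x → ∑[ t < n ] (+ 0 * vertexO t x) ≡ + 0
  no-singletons x = sum-zero {n} (λ _ → + 0) (λ _ → refl)

  closed-trail-trivial : ∀ {v es} → Walk ends (_∈ F) v v es → Unique es → es ≡ []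
  closed-trail-trivial {es = []} _ _ = refl
  closed-trail-trivial {v} {e ∷ es} walk (e∉es ∷ _) = contradiction q∣μ (∤sign q-prime (first-edge-sign walk))
    where
    open TwoWalks walk (nil {v = v})
    relation : Relation (λ _ → + 0) (+ 0) (+ 0) (+ 1) (+ 0)
    relation x = subst (+ q ∣_) (sym (begin
      ∑[ t < n ] (+ 0 * vertexO t x) + telescoped vertexO (+ 0) (+ 0) x + telescoped (vertexB T θ) (+ 1) (+ 0) x
        ≡⟨ cong (λ z → z + telescoped vertexO (+ 0) (+ 0) x + telescoped (vertexB T θ) (+ 1) (+ 0) x)
                (no-singletons x) ⟩
      + 0 + (+ 0 * (o - o) + + 0 * (o - o)) + (+ 1 * (b - b) + + 0 * (b - b))
        ≡⟨ cancel o b ⟩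
      + 0 ∎)) ∣0
      where
      open ≡-Reasoning
      o = vertexO v x
      b = vertexB T θ v x
      cancel : ∀ o b → + 0 + (+ 0 * (o - o) + + 0 * (o - o)) + (+ 1 * (b - b) + + 0 * (b - b)) ≡ + 0
      cancel = solve-∀
    e∈F : e ∈ F
    e∈F with walk-edges walk
    ... | e∈F ∷ _ = e∈F
    flows≡μ : flows (+ 1) (+ 0) e ≡ μ e v
    flows≡μ = trans (cong₂ _+_ (*-identityˡ (flow walk e)) refl)
                    (trans (+-identityʳ (flow walk e)) (first-edge-flow walk (All¬⇒¬Any e∉es)))
    q∣μ : + q ∣ μ e v
    q∣μ = subst (+ q ∣_) flows≡μ (β-flows-vanish (λ _ → + 0) (λ _ _ → refl) (+ 0) (+ 0) (+ 1) (+ 0) relation e e∈F)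

  -- If θ t = θ t′ then θ t (t° − t′°) − (t• − t′•) = (θ t′ − θ t) t′° is zero, yet its •-coefficients are not.
  terminals-with-equal-θ-separated : ∀ {t t′} → t ∈ T → t′ ∈ T → t ≢ t′ → θ t ≐[ q ] θ t′ → ¬ Reach ends F t t′
  terminals-with-equal-θ-separated {t} {t′} t∈T t′∈T t≢t′ θt≐θt′ (_ , walk) =
    ∤sign q-prime (inj₁ refl) $ subst (+ q ∣_) at-t′ $
      β-telescoped-vanishes (λ _ → + 0) (λ _ _ → refl) (θ t) (+ 0) (- + 1) (+ 0) relation (t′ , false)
    where
    open TwoWalks walk (nil {v = t})
    relation : Relation (λ _ → + 0) (θ t) (+ 0) (- + 1) (+ 0)
    relation x = subst (+ q ∣_) (sym (begin
      ∑[ u < n ] (+ 0 * vertexO u x) + telescoped vertexO (θ t) (+ 0) x + telescoped (vertexB T θ) (- + 1) (+ 0) x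
        ≡⟨ cong₂ _+_ (cong (_+ telescoped vertexO (θ t) (+ 0) x) (no-singletons x))
                     (telescoped-at-terminals t∈T t′∈T t∈T (- + 1) (+ 0) x) ⟩
      + 0 + (θ t * (o - o′) + + 0 * (o - o)) + (- + 1 * (θ t * o - θ t′ * o′) + + 0 * (θ t * o - θ t * o))
        ≡⟨ simplify (θ t) (θ t′) o o′ ⟩
      - o′ * (θ t - θ t′) ∎)) (∣n⇒∣m*n (- o′) (∣ᵤ⇒∣ θt≐θt′))
      where
      open ≡-Reasoning
      o = vertexO t x
      o′ = vertexO t′ x
      simplify : ∀ a a′ o o′ →
        + 0 + (a * (o - o′) + + 0 * (o - o)) + (- + 1 * (a * o - a′ * o′) + + 0 * (a * o - a * o)) ≡ - o′ * (a - a′)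
      simplify = solve-∀
    at-t′ : telescoped vertexO (- + 1) (+ 0) (t′ , false) ≡ + 1
    at-t′ rewrite vertexO-other false t≢t′ | vertexO-self t′ = refl

  -- (θ t − θ s) s° − θ t (s° − t°) + (s• − t•) = 0, where the first term is a multiple of the singleton s.
  singleton-separated : ∀ {s t} → s ∈ S → t ∈ T → s ≢ t → ¬ Reach ends F s t
  singleton-separated {s} {t} s∈S t∈T s≢t (_ , walk) =
    ∤sign q-prime (inj₂ refl) $ subst (+ q ∣_) at-t $
      β-telescoped-vanishes a a-outside (- θ t) (+ 0) (+ 1) (+ 0) relation (t , false)
    where
    open TwoWalks walk (nil {v = s})
    a : Fin n → ℤ
    a = point s (θ t - θ s)
    a-outside : ∀ u → u ∉ S → a u ≡ + 0
    a-outside u u∉S = point-other (θ t - θ s) (λ s≡u → u∉S (subst (_∈ S) s≡u s∈S))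
    relation : Relation a (- θ t) (+ 0) (+ 1) (+ 0)
    relation x = subst (+ q ∣_) (sym (begin
      ∑[ u < n ] (a u * vertexO u x) + telescoped vertexO (- θ t) (+ 0) x + telescoped (vertexB T θ) (+ 1) (+ 0) x
        ≡⟨ cong₂ _+_ (cong (_+ telescoped vertexO (- θ t) (+ 0) x) (sum-point s (θ t - θ s) (λ u → vertexO u x)))
                     (telescoped-at-terminals (S⊆T s∈S) t∈T (S⊆T s∈S) (+ 1) (+ 0) x) ⟩
      (θ t - θ s) * o + (- θ t * (o - o′) + + 0 * (o - o)) + (+ 1 * (θ s * o - θ t * o′) + + 0 * (θ s * o - θ s * o))
        ≡⟨ cancel (θ s) (θ t) o o′ ⟩
      + 0 ∎)) ∣0
      where
      open ≡-Reasoning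
      o = vertexO s x
      o′ = vertexO t x
      cancel : ∀ a a′ o o′ →
        (a′ - a) * o + (- a′ * (o - o′) + + 0 * (o - o)) + (+ 1 * (a * o - a′ * o′) + + 0 * (a * o - a * o)) ≡ + 0
      cancel = solve-∀
    at-t : telescoped vertexO (+ 1) (+ 0) (t , false) ≡ - + 1
    at-t rewrite vertexO-other false s≢t | vertexO-self t = refl

  -- The coefficients are chosen so that the terms at t₁, t₂, t₃ cancel; the •-coefficient of the
  -- walk to t₂ is θ t₁ − θ t₃, which the evaluation at t₂ then picks out.
  terminal-between-forces-equal-θ : ∀ {t₁ t₂ t₃} → t₁ ∈ T → t₂ ∈ T → t₃ ∈ T → t₁ ≢ t₂ → t₃ ≢ t₂ →
                                    Reach ends F t₁ t₂ → Reach ends F t₁ t₃ → θ t₁ ≐[ q ] θ t₃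
  terminal-between-forces-equal-θ {t₁} {t₂} {t₃} t₁∈T t₂∈T t₃∈T t₁≢t₂ t₃≢t₂ (_ , W₁) (_ , W₂) =
    ∣⇒∣ᵤ $ subst (+ q ∣_) (neg-involutive β₁) $ ∣m⇒∣-m $
      subst (+ q ∣_) at-t₂ (β-telescoped-vanishes (λ _ → + 0) (λ _ _ → refl) α₁ α₂ β₁ β₂ relation (t₂ , false))
    where
    open TwoWalks W₁ W₂
    β₁ = θ t₁ - θ t₃
    β₂ = θ t₂ - θ t₁
    α₁ = - θ t₂ * β₁
    α₂ = - θ t₃ * β₂
    relation : Relation (λ _ → + 0) α₁ α₂ β₁ β₂
    relation x = subst (+ q ∣_) (sym (begin
      ∑[ u < n ] (+ 0 * vertexO u x) + telescoped vertexO α₁ α₂ x + telescoped (vertexB T θ) β₁ β₂ x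
        ≡⟨ cong₂ _+_ (cong (_+ telescoped vertexO α₁ α₂ x) (no-singletons x))
                     (telescoped-at-terminals t₁∈T t₂∈T t₃∈T β₁ β₂ x) ⟩
      + 0 + (α₁ * (o₁ - o₂) + α₂ * (o₁ - o₃)) + (β₁ * (θ t₁ * o₁ - θ t₂ * o₂) + β₂ * (θ t₁ * o₁ - θ t₃ * o₃))
        ≡⟨ cancel (θ t₁) (θ t₂) (θ t₃) o₁ o₂ o₃ ⟩
      + 0 ∎)) ∣0
      where
      open ≡-Reasoning
      o₁ = vertexO t₁ x
      o₂ = vertexO t₂ x
      o₃ = vertexO t₃ x
      cancel : ∀ a₁ a₂ a₃ o₁ o₂ o₃ →
        + 0 + (- a₂ * (a₁ - a₃) * (o₁ - o₂) + - a₃ * (a₂ - a₁) * (o₁ - o₃)) +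
        ((a₁ - a₃) * (a₁ * o₁ - a₂ * o₂) + (a₂ - a₁) * (a₁ * o₁ - a₃ * o₃)) ≡ + 0
      cancel = solve-∀
    at-t₂ : telescoped vertexO β₁ β₂ (t₂ , false) ≡ - β₁
    at-t₂ rewrite vertexO-other false t₁≢t₂ | vertexO-other false t₃≢t₂ | vertexO-self t₂ = simplify β₁ β₂
      where
      simplify : ∀ b₁ b₂ → b₁ * (+ 0 - + 1) + b₂ * (+ 0 - + 0) ≡ - b₁
      simplify = solve-∀

  independent⇒admissible : ∀ Z → IsComponent ends F Z → Admissible q ends T θ S F Z
  independent⇒admissible Z component = tree , separates , no-three-terminals , singleton-alone
    where
    terminal : ∀ {x} → x ∈ Z ∩ T → x ∈ T
    terminal = proj₂ ∘ x∈p∩q⁻ Z T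

    connected : ∀ {x y} → x ∈ Z ∩ T → y ∈ Z ∩ T → Reach ends F x y
    connected x∈ y∈ = component-connected component (proj₁ (x∈p∩q⁻ Z T x∈)) (proj₁ (x∈p∩q⁻ Z T y∈))

    tree : IsInducedTree ends F Z
    tree = (proj₁ component , Equivalence.from (proj₂ component _) reach-refl)
         , (λ u w u∈Z w∈Z →
              _ , induced-walk (component-closed component) u∈Z (proj₂ (component-connected component u∈Z w∈Z)))
         , (λ v es _ walk unique → closed-trail-trivial (map-walk proj₁ walk) unique)

    separates : SeparatesTerminals q T θ Z
    separates t∈ t′∈ t≢t′ θt≐θt′ =
      terminals-with-equal-θ-separated (terminal t∈) (terminal t′∈) t≢t′ θt≐θt′ (connected t∈ t′∈)

    no-three-terminals : ¬ Distinct₃ (Z ∩ T)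
    no-three-terminals (t₁ , t₂ , t₃ , t₁∈ , t₂∈ , t₃∈ , t₁≢t₂ , t₁≢t₃ , t₂≢t₃) =
      separates t₁∈ t₃∈ t₁≢t₃
        (terminal-between-forces-equal-θ (terminal t₁∈) (terminal t₂∈) (terminal t₃∈) t₁≢t₂ (t₂≢t₃ ∘ sym)
                                         (connected t₁∈ t₂∈) (connected t₁∈ t₃∈))

    singleton-alone : Nonempty (Z ∩ S) → ¬ Distinct₂ (Z ∩ T)
    singleton-alone (s , s∈Z∩S) (t₁ , t₂ , t₁∈ , t₂∈ , t₁≢t₂) with x∈p∩q⁻ Z S s∈Z∩S | s ≟ t₁
    ... | _   , s∈S | yes refl = singleton-separated s∈S (terminal t₂∈) t₁≢t₂ (connected t₁∈ t₂∈)
    ... | s∈Z , s∈S | no s≢t₁  =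
      singleton-separated s∈S (terminal t₁∈) s≢t₁ (connected (x∈p∩q⁺ (s∈Z , S⊆T s∈S)) t₁∈)

module Backward {n m q : ℕ} (ends : Ends n m) (μ : Fin m → Fin n → ℤ) (μ-signs : IsMu ends μ)
                (T : Subset n) (θ : Fin n → ℤ) (S : Subset n) (S⊆T : S ⊆ T) (F : Subset m) (q-prime : Prime q)
                (admissible : ∀ Z → IsComponent ends F Z → Admissible q ends T θ S F Z) where
  open import Data.Bool using (if_then_else_)
  open import Data.Vec using (lookup)
  open import Data.Vec.Properties using ([]=⇒lookup; lookup⇒[]=)
  open import Data.Integer using (_+_; _*_)
  open import Data.Integer.Properties using (*-zeroˡ; *-zeroʳ; *-identityˡ; *-identityʳ; +-identityˡ; +-identityʳ)
  open import Data.Integer.Divisibility.Signed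
    using (_∣_; _∣?_; ∣⇒∣ᵤ; ∣m⇒∣m*n; ∣n⇒∣m*n; ∣m∣n⇒∣m+n; ∣m+n∣n⇒∣m)
  open import Data.Fin.Properties using (any?)
  open import Data.Fin.Subset.Properties using (_∈?_; x∈p∩q⁺)
  open import Data.List using (_∷_)
  open import Data.List.Relation.Unary.All.Properties using (¬Any⇒All¬)
  open import Data.List.Relation.Unary.AllPairs using (_∷_)
  open import Relation.Nullary.Decidable using (_×-dec_; ¬?; decidable-stable)
  open import Function.Bundles using (_⇔_; mk⇔; Equivalence)
  open Equivalence using (to; from)
  open Sums
  open Modular q
  open Walks ends
  open Subsets using (subset; ∈-subset)
  open Flows ends μ μ-signs
  open Coordinates ends μ μ-signs T θ

  private
    lookup-∉ : ∀ {w} → w ∉ T → lookup T w ≡ false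
    lookup-∉ {w} w∉T with lookup T w in T[w]
    ... | true  = contradiction (lookup⇒[]= w T T[w]) w∉T
    ... | false = refl

  Avoiding : Fin m → Fin m → Set
  Avoiding e e′ = e′ ∈ F × e′ ≢ e

  module _ (a : Fin n → ℤ) (bᵒ bᵇ : Fin m → ℤ)
           (a-outside : ∀ t → t ∉ S → a t ≡ + 0) (b-outside : ∀ e → e ∉ F → bᵒ e ≡ + 0 × bᵇ e ≡ + 0)
           (vanishes : ∀ x → + q ∣ combination a bᵒ bᵇ x) where

    nonterminal-∂ : ∀ {w} → w ∉ T → + q ∣ ∂ bᵒ w × + q ∣ ∂ bᵇ w
    nonterminal-∂ {w} w∉T =
      subst (+ q ∣_) at-false (vanishes (w , false)) , subst (+ q ∣_) at-true (vanishes (w , true))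
      where
      open ≡-Reasoning
      at-false : combination a bᵒ bᵇ (w , false) ≡ ∂ bᵒ w
      at-false = begin
        combination a bᵒ bᵇ (w , false)
          ≡⟨ combination-false a bᵒ bᵇ w ⟩
        a w + ∂ bᵒ w + bulletFactor false w * ∂ bᵇ w
          ≡⟨ cong₂ (λ x c → x + ∂ bᵒ w + c * ∂ bᵇ w) (a-outside w (w∉T ∘ S⊆T))
                                                     (cong (if_then θ w else + 0) (lookup-∉ w∉T)) ⟩
        + 0 + ∂ bᵒ w + + 0
          ≡⟨ trans (+-identityʳ (+ 0 + ∂ bᵒ w)) (+-identityˡ (∂ bᵒ w)) ⟩
        ∂ bᵒ w ∎
      at-true : combination a bᵒ bᵇ (w , true) ≡ ∂ bᵇ w
      at-true = begin
        combination a bᵒ bᵇ (w , true) ≡⟨ combination-true a bᵒ bᵇ w ⟩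
        bulletFactor true w * ∂ bᵇ w   ≡⟨ cong (_* ∂ bᵇ w) (cong (if_then + 0 else + 1) (lookup-∉ w∉T)) ⟩
        + 1 * ∂ bᵇ w                   ≡⟨ *-identityˡ (∂ bᵇ w) ⟩
        ∂ bᵇ w                         ∎

    terminal-∂ : ∀ {t} → t ∈ T → + q ∣ a t + ∂ bᵒ t + θ t * ∂ bᵇ t
    terminal-∂ {t} t∈T = subst (+ q ∣_) at-false (vanishes (t , false))
      where
      at-false : combination a bᵒ bᵇ (t , false) ≡ a t + ∂ bᵒ t + θ t * ∂ bᵇ t
      at-false = trans (combination-false a bᵒ bᵇ t)
                       (cong (λ b → a t + ∂ bᵒ t + (if b then θ t else + 0) * ∂ bᵇ t) ([]=⇒lookup t∈T))

    module Side (e : Fin m) {Q : Fin n → Set} (Q? : ∀ w → Dec (Q w))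
                (Q-closed : ∀ e′ → e′ ∈ F → e′ ≢ e → Q (proj₁ (ends e′)) ⇔ Q (proj₂ (ends e′)))
                {p p′} (endpoints : Endpoints e p p′) (p∈Q : Q p) (p′∉Q : ¬ Q p′) where

      χ : Fin n → ℤ
      χ w = indicator (Q? w)

      χ-closed : ∀ e′ → e′ ∈ F → e′ ≢ e → χ (proj₁ (ends e′)) ≡ χ (proj₂ (ends e′))
      χ-closed e′ e′∈F e′≢e with Q? (proj₁ (ends e′)) | Q? (proj₂ (ends e′))
      ... | yes _  | yes _   = refl
      ... | no _   | no _    = refl
      ... | yes Q₁ | no ¬Q₂  = contradiction (to (Q-closed e′ e′∈F e′≢e) Q₁) ¬Q₂
      ... | no ¬Q₁ | yes Q₂  = contradiction (from (Q-closed e′ e′∈F e′≢e) Q₂) ¬Q₁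

      coboundary-χ-at-e : coboundary χ e ≡ μ e p
      coboundary-χ-at-e = begin
        coboundary χ e              ≡⟨ coboundary-endpoints χ endpoints ⟩
        μ e p * χ p + μ e p′ * χ p′ ≡⟨ cong₂ (λ x y → μ e p * x + μ e p′ * y) (indicator-yes (Q? p) p∈Q)
                                                                              (indicator-no (Q? p′) p′∉Q) ⟩
        μ e p * + 1 + μ e p′ * + 0  ≡⟨ cong₂ _+_ (*-identityʳ (μ e p)) (*-zeroʳ (μ e p′)) ⟩
        μ e p + + 0                 ≡⟨ +-identityʳ (μ e p) ⟩
        μ e p                       ∎
        where open ≡-Reasoning

      side-sum : ∀ b → (∀ e′ → e′ ∉ F → b e′ ≡ + 0) → ∑[ w < n ] (χ w * ∂ b w) ≡ b e * μ e p
      side-sum b b-outside′ = begin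
        ∑[ w < n ] (χ w * ∂ b w)             ≡⟨ ∂-adjoint χ b ⟩
        ∑[ e′ < m ] (b e′ * coboundary χ e′) ≡⟨ sum-supported _ e other-edge ⟩
        b e * coboundary χ e                 ≡⟨ cong (b e *_) coboundary-χ-at-e ⟩
        b e * μ e p                          ∎
        where
        open ≡-Reasoning
        other-edge : ∀ e′ → e′ ≢ e → b e′ * coboundary χ e′ ≡ + 0
        other-edge e′ e′≢e with e′ ∈? F
        ... | yes e′∈F = trans (cong (b e′ *_) (coboundary-constant χ e′ (χ-closed e′ e′∈F e′≢e))) (*-zeroʳ (b e′))
        ... | no e′∉F  = trans (cong (_* coboundary χ e′) (b-outside′ e′ e′∉F)) (*-zeroˡ (coboundary χ e′))

      ∂-vanishing-on-side : ∀ b → (∀ e′ → e′ ∉ F → b e′ ≡ + 0) → (∀ w → Q w → + q ∣ ∂ b w) → + q ∣ b e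
      ∂-vanishing-on-side b b-outside′ q∣∂b =
        ∣-cancel-sign (b e) (proj₁ (μ-opposite endpoints)) (subst (+ q ∣_) (side-sum b b-outside′) (∣-sum _ term))
        where
        term : ∀ w → + q ∣ χ w * ∂ b w
        term w with Q? w
        ... | yes Qw = ∣n⇒∣m*n (+ 1) (q∣∂b w Qw)
        ... | no _   = ∣0

      no-terminal : (∀ w → Q w → w ∉ T) → + q ∣ bᵒ e × + q ∣ bᵇ e
      no-terminal nonterminal =
        ∂-vanishing-on-side bᵒ (λ e′ → proj₁ ∘ b-outside e′) (λ w → proj₁ ∘ nonterminal-∂ ∘ nonterminal w) ,
        ∂-vanishing-on-side bᵇ (λ e′ → proj₂ ∘ b-outside e′) (λ w → proj₂ ∘ nonterminal-∂ ∘ nonterminal w)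

      at-most-one-terminal : ∀ {t} → t ∉ S → (∀ w → Q w → w ∈ T → w ≡ t) → + q ∣ bᵒ e + θ t * bᵇ e
      at-most-one-terminal {t} t∉S only-t = ∂-vanishing-on-side b b-outside′ q∣∂b
        where
        b = λ e′ → bᵒ e′ + θ t * bᵇ e′
        b-outside′ : ∀ e′ → e′ ∉ F → b e′ ≡ + 0
        b-outside′ e′ e′∉F rewrite proj₁ (b-outside e′ e′∉F) | proj₂ (b-outside e′ e′∉F) =
          cong (_+_ (+ 0)) (*-zeroʳ (θ t))
        without-a : a t + ∂ bᵒ t + θ t * ∂ bᵇ t ≡ ∂ b t
        without-a = begin
          a t + ∂ bᵒ t + θ t * ∂ bᵇ t ≡⟨ cong (λ x → x + ∂ bᵒ t + θ t * ∂ bᵇ t) (a-outside t t∉S) ⟩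
          + 0 + ∂ bᵒ t + θ t * ∂ bᵇ t ≡⟨ cong (_+ θ t * ∂ bᵇ t) (+-identityˡ (∂ bᵒ t)) ⟩
          ∂ bᵒ t + θ t * ∂ bᵇ t       ≡⟨ ∂-linear bᵒ bᵇ (θ t) t ⟨
          ∂ b t                       ∎
          where open ≡-Reasoning
        q∣∂b : ∀ w → Q w → + q ∣ ∂ b w
        q∣∂b w Qw with w ∈? T
        ... | yes w∈T with only-t w Qw w∈T
        ...   | refl = subst (+ q ∣_) without-a (terminal-∂ w∈T)
        q∣∂b w Qw | no w∉T = subst (+ q ∣_) (sym (∂-linear bᵒ bᵇ (θ t) w))
          (∣m∣n⇒∣m+n (proj₁ (nonterminal-∂ w∉T)) (∣n⇒∣m*n (θ t) (proj₂ (nonterminal-∂ w∉T))))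

    module Cut (e : Fin m) (e∈F : e ∈ F)
               (reach? : ∀ w → Dec (Reach ends F (proj₁ (ends e)) w))
               (avoid? : ∀ w → Dec (Reachable (Avoiding e) (proj₁ (ends e)) w)) where
      u = proj₁ (ends e)
      v = proj₂ (ends e)

      Z : Subset n
      Z = subset reach?

      Z-component : IsComponent ends F Z
      Z-component = u , ∈-subset reach?

      Z-admissible = admissible Z Z-component
      Z-acyclic = proj₂ (proj₂ (proj₁ Z-admissible))
      separates = proj₁ (proj₂ Z-admissible)
      no-three-terminals = proj₁ (proj₂ (proj₂ Z-admissible))
      singleton-alone = proj₂ (proj₂ (proj₂ Z-admissible))

      A B : Fin n → Set
      A = Reachable (Avoiding e) u
      B w = Reach ends F u w × ¬ A w

      reach⇒∈Z : ∀ {w} → Reach ends F u w → w ∈ Z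
      reach⇒∈Z = from (∈-subset reach? _)

      A⇒reach : ∀ {w} → A w → Reach ends F u w
      A⇒reach (_ , walk) = _ , map-walk proj₁ walk

      u-reaches-v : Reach ends F u v
      u-reaches-v = reach-across e∈F reach-refl

      v∉A : ¬ A v
      v∉A (_ , walk) with walk⇒trail walk
      ... | es , trail , unique
        with Z-acyclic v (e ∷ es) v∈Z (induced-walk (component-closed Z-component) v∈Z cycle)
                       (¬Any⇒All¬ es (avoids trail) ∷ unique)
        where
        v∈Z = reach⇒∈Z u-reaches-v
        cycle = bwd e e∈F refl (map-walk proj₁ trail)
      ... | ()

      A-closed : ∀ e′ → e′ ∈ F → e′ ≢ e → A (proj₁ (ends e′)) ⇔ A (proj₂ (ends e′))
      A-closed e′ e′∈F e′≢e = mk⇔ (reach-across (e′∈F , e′≢e)) (reach-back (e′∈F , e′≢e))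

      B-closed : ∀ e′ → e′ ∈ F → e′ ≢ e → B (proj₁ (ends e′)) ⇔ B (proj₂ (ends e′))
      B-closed e′ e′∈F e′≢e =
        mk⇔ (λ (reach , ¬A) → reach-across e′∈F reach , ¬A ∘ from (A-closed e′ e′∈F e′≢e))
            (λ (reach , ¬A) → reach-back e′∈F reach , ¬A ∘ to (A-closed e′ e′∈F e′≢e))

      B? : ∀ w → Dec (B w)
      B? w = reach? w ×-dec ¬? (avoid? w)

      module A-side = Side e avoid? A-closed (inj₁ refl) reach-refl v∉A
      module B-side = Side e B? B-closed (inj₂ refl) (u-reaches-v , v∉A) (λ (_ , u∉A) → u∉A reach-refl)

      terminals-on-both-sides : ∀ {t₁ t₂} → A t₁ → t₁ ∈ T → B t₂ → t₂ ∈ T → + q ∣ bᵒ e × + q ∣ bᵇ e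
      terminals-on-both-sides {t₁} {t₂} t₁∈A t₁∈T (t₂∈Z , t₂∉A) t₂∈T =
        ∣-linear-at-two-points q-prime (bᵒ e) (bᵇ e) (θ t₁) (θ t₂) (separates t₁∈ t₂∈ t₁≢t₂ ∘ ∣⇒∣ᵤ)
          (A-side.at-most-one-terminal (non-singleton (A⇒reach t₁∈A)) only-t₁)
          (B-side.at-most-one-terminal (non-singleton t₂∈Z) only-t₂)
        where
        t₁∈ = x∈p∩q⁺ (reach⇒∈Z (A⇒reach t₁∈A) , t₁∈T)
        t₂∈ = x∈p∩q⁺ (reach⇒∈Z t₂∈Z , t₂∈T)
        t₁≢t₂ : t₁ ≢ t₂
        t₁≢t₂ refl = t₂∉A t₁∈A
        non-singleton : ∀ {t} → Reach ends F u t → t ∉ S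
        non-singleton reach t∈S =
          singleton-alone (_ , x∈p∩q⁺ (reach⇒∈Z reach , t∈S)) (t₁ , t₂ , t₁∈ , t₂∈ , t₁≢t₂)
        only-t₁ : ∀ w → A w → w ∈ T → w ≡ t₁
        only-t₁ w w∈A w∈T with w ≟ t₁
        ... | yes w≡t₁ = w≡t₁
        ... | no w≢t₁  = contradiction (w , t₁ , t₂ , x∈p∩q⁺ (reach⇒∈Z (A⇒reach w∈A) , w∈T) , t₁∈ , t₂∈ ,
                                        w≢t₁ , (λ { refl → t₂∉A w∈A }) , t₁≢t₂)
                                       no-three-terminals
        only-t₂ : ∀ w → B w → w ∈ T → w ≡ t₂
        only-t₂ w (w∈Z , w∉A) w∈T with w ≟ t₂
        ... | yes w≡t₂ = w≡t₂
        ... | no w≢t₂  = contradiction (t₁ , t₂ , w , t₁∈ , t₂∈ , x∈p∩q⁺ (reach⇒∈Z w∈Z , w∈T) ,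
                                        t₁≢t₂ , (λ { refl → w∉A t₁∈A }) , w≢t₂ ∘ sym)
                                       no-three-terminals

      coefficients : + q ∣ bᵒ e × + q ∣ bᵇ e
      coefficients with any? (λ w → B? w ×-dec w ∈? T)
      ... | no no-terminal-in-B = B-side.no-terminal (λ w w∈B w∈T → no-terminal-in-B (w , w∈B , w∈T))
      ... | yes (t₂ , t₂∈B , t₂∈T) with any? (λ w → avoid? w ×-dec w ∈? T)
      ...   | no no-terminal-in-A = A-side.no-terminal (λ w w∈A w∈T → no-terminal-in-A (w , w∈A , w∈T))
      ...   | yes (t₁ , t₁∈A , t₁∈T) = terminals-on-both-sides t₁∈A t₁∈T t₂∈B t₂∈T

    edge-coefficients : ∀ e → + q ∣ bᵒ e × + q ∣ bᵇ e
    edge-coefficients e with e ∈? F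
    ... | no e∉F  = let (bᵒ≡0 , bᵇ≡0) = b-outside e e∉F in
                    subst (+ q ∣_) (sym bᵒ≡0) ∣0 , subst (+ q ∣_) (sym bᵇ≡0) ∣0
    ... | yes e∈F = decidable-stable ((+ q ∣? bᵒ e) ×-dec (+ q ∣? bᵇ e)) λ ¬coefficients →
      ¬¬-decidable (Reach ends F (proj₁ (ends e))) λ reach? →
      ¬¬-decidable (Reachable (Avoiding e) (proj₁ (ends e))) λ avoid? →
      ¬coefficients (Cut.coefficients e e∈F reach? avoid?)

    singleton-coefficients : ∀ t → t ∈ S → + q ∣ a t
    singleton-coefficients t t∈S =
      ∣m+n∣n⇒∣m (∣m+n∣n⇒∣m (terminal-∂ (S⊆T t∈S)) (∣n⇒∣m*n (θ t) (q∣∂ bᵇ (proj₂ ∘ edge-coefficients))))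
                (q∣∂ bᵒ (proj₁ ∘ edge-coefficients))
      where
      q∣∂ : ∀ b → (∀ e → + q ∣ b e) → + q ∣ ∂ b t
      q∣∂ b q∣b = ∣-sum _ (λ e → ∣m⇒∣m*n _ (q∣b e))

  admissible⇒independent : LinIndep q ends T θ μ S F
  admissible⇒independent a bᵒ bᵇ a-outside b-outside vanishes =
    (λ t t∈S → ∣⇒≐0 (singleton-coefficients a bᵒ bᵇ a-outside b-outside vanishes′ t t∈S)) ,
    (λ e _ → ∣⇒≐0 (proj₁ (edge-coefficients a bᵒ bᵇ a-outside b-outside vanishes′ e)) ,
             ∣⇒≐0 (proj₂ (edge-coefficients a bᵒ bᵇ a-outside b-outside vanishes′ e)))
    where
    vanishes′ : ∀ x → + q ∣ combination a bᵒ bᵇ x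
    vanishes′ x = subst (+ q ∣_) (Σℤ≡combination a bᵒ bᵇ x) (≐0⇒∣ (vanishes x))

open import Data.Nat using (ℕ; _≤_; _+_)
open import Data.Integer using (ℤ)
open import Data.Fin using (Fin)
open import Data.Fin.Subset using (Subset; _⊆_; _∩_; ∣_∣)
open import Data.Product using (_×_)
open import Function.Bundles using (_⇔_)

module _ {n s q : ℕ} {T : Subset n} {B : Fin s → Subset n} {θ : Fin n → ℤ} where
  open import Data.Nat using (_≤?_)
  open import Data.Nat.Properties using (≤-trans; ≰⇒>; +-mono-≤; m≤m+n; +-identityʳ)
  open import Data.Fin.Subset.Properties using (x∈p∩q⁺; x∈p∩q⁻; p⊆q⇒∣p∣≤∣q∣)
  open import Function.Bundles using (mk⇔; Equivalence)
  open Equivalence using (to; from)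
  open Subsets

  blocks-bounded⇔separates : IsPartition T B → IsTheta q T B θ → ∀ Z →
                             (∀ j → ∣ Z ∩ B j ∣ ≤ 1) ⇔ SeparatesTerminals q T θ Z
  blocks-bounded⇔separates (_ , _ , T⇔⋃B) θ-blocks Z = mk⇔ separates bounded
    where
    separates : (∀ j → ∣ Z ∩ B j ∣ ≤ 1) → SeparatesTerminals q T θ Z
    separates ≤1 {t} {t′} t∈ t′∈ t≢t′ θt≐θt′ with x∈p∩q⁻ Z T t∈ | x∈p∩q⁻ Z T t′∈
    ... | t∈Z , t∈T | t′∈Z , t′∈T with to (θ-blocks t t′ t∈T t′∈T) θt≐θt′
    ...   | j , t∈Bj , t′∈Bj =
      contradiction (≤-trans (Distinct₂⇒2≤∣p∣ (t , t′ , x∈p∩q⁺ (t∈Z , t∈Bj) , x∈p∩q⁺ (t′∈Z , t′∈Bj) , t≢t′)) (≤1 j))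
                    λ { (s≤s ()) }
    bounded : SeparatesTerminals q T θ Z → ∀ j → ∣ Z ∩ B j ∣ ≤ 1
    bounded separated j with ∣ Z ∩ B j ∣ ≤? 1
    ... | yes ≤1 = ≤1
    ... | no ≰1 with 2≤∣p∣⇒Distinct₂ (Z ∩ B j) (≰⇒> ≰1)
    ...   | t , t′ , t∈ , t′∈ , t≢t′ with x∈p∩q⁻ Z (B j) t∈ | x∈p∩q⁻ Z (B j) t′∈
    ...     | t∈Z , t∈Bj | t′∈Z , t′∈Bj =
      contradiction (from (θ-blocks t t′ t∈T t′∈T) (j , t∈Bj , t′∈Bj))
                    (separated (x∈p∩q⁺ (t∈Z , t∈T)) (x∈p∩q⁺ (t′∈Z , t′∈T)) t≢t′)
      where
      t∈T = from (T⇔⋃B t) (j , t∈Bj)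
      t′∈T = from (T⇔⋃B t′) (j , t′∈Bj)

  private
    +-bounded : ∀ {a b} → b ≤ a → a ≤ 2 → (1 ≤ b → a ≤ 1) → a + b ≤ 2
    +-bounded {a} {zero}  _   a≤2 _   = subst (_≤ 2) (sym (+-identityʳ a)) a≤2
    +-bounded {a} {suc b} b<a _   a≤1 = +-mono-≤ (a≤1 (s≤s z≤n)) (≤-trans b<a (a≤1 (s≤s z≤n)))

    3≰2 : ∀ {k} → 3 ≤ k → k ≤ 2 → ⊥
    3≰2 (s≤s (s≤s (s≤s _))) (s≤s (s≤s ()))

  terminal-count⇔ : ∀ {S} → S ⊆ T → ∀ Z →
    ∣ Z ∩ T ∣ + ∣ Z ∩ S ∣ ≤ 2 ⇔ (¬ Distinct₃ (Z ∩ T) × (Nonempty (Z ∩ S) → ¬ Distinct₂ (Z ∩ T)))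
  terminal-count⇔ {S} S⊆T Z = mk⇔ (λ ≤2 → no-three ≤2 , singleton-alone ≤2) bounded
    where
    no-three : ∣ Z ∩ T ∣ + ∣ Z ∩ S ∣ ≤ 2 → ¬ Distinct₃ (Z ∩ T)
    no-three ≤2 three = 3≰2 (≤-trans (Distinct₃⇒3≤∣p∣ three) (m≤m+n _ _)) ≤2

    singleton-alone : ∣ Z ∩ T ∣ + ∣ Z ∩ S ∣ ≤ 2 → Nonempty (Z ∩ S) → ¬ Distinct₂ (Z ∩ T)
    singleton-alone ≤2 (_ , s∈) two = 3≰2 (+-mono-≤ (Distinct₂⇒2≤∣p∣ two) (x∈p⇒1≤∣p∣ s∈)) ≤2

    bounded : ¬ Distinct₃ (Z ∩ T) × (Nonempty (Z ∩ S) → ¬ Distinct₂ (Z ∩ T)) → ∣ Z ∩ T ∣ + ∣ Z ∩ S ∣ ≤ 2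
    bounded (no-three′ , alone) = +-bounded (p⊆q⇒∣p∣≤∣q∣ Z∩S⊆Z∩T) ∣Z∩T∣≤2 ∣Z∩T∣≤1
      where
      Z∩S⊆Z∩T : Z ∩ S ⊆ Z ∩ T
      Z∩S⊆Z∩T x∈ = let (x∈Z , x∈S) = x∈p∩q⁻ Z S x∈ in x∈p∩q⁺ (x∈Z , S⊆T x∈S)
      ∣Z∩T∣≤2 : ∣ Z ∩ T ∣ ≤ 2
      ∣Z∩T∣≤2 with ∣ Z ∩ T ∣ ≤? 2
      ... | yes ≤2 = ≤2
      ... | no ≰2  = contradiction (3≤∣p∣⇒Distinct₃ (Z ∩ T) (≰⇒> ≰2)) no-three′
      ∣Z∩T∣≤1 : 1 ≤ ∣ Z ∩ S ∣ → ∣ Z ∩ T ∣ ≤ 1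
      ∣Z∩T∣≤1 1≤ with ∣ Z ∩ T ∣ ≤? 1
      ... | yes ≤1 = ≤1
      ... | no ≰1  = contradiction (2≤∣p∣⇒Distinct₂ (Z ∩ T) (≰⇒> ≰1)) (alone (1≤∣p∣⇒Nonempty (Z ∩ S) 1≤))

  admissible⇔conditions : ∀ {m} {ends : Ends n m} {S F} → IsPartition T B → IsTheta q T B θ → S ⊆ T → ∀ Z →
    Admissible q ends T θ S F Z ⇔ (IsInducedTree ends F Z × (∀ j → ∣ Z ∩ B j ∣ ≤ 1) × ∣ Z ∩ T ∣ + ∣ Z ∩ S ∣ ≤ 2)
  admissible⇔conditions partition θ-blocks S⊆T Z = mk⇔
    (λ (tree , separated , no-three , alone) → tree , from blocks⇔ separated , from count⇔ (no-three , alone))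
    (λ (tree , bounded , count) → tree , to blocks⇔ bounded , to count⇔ count)
    where
    blocks⇔ = blocks-bounded⇔separates partition θ-blocks Z
    count⇔ = terminal-count⇔ S⊆T Z

lemma3 : ∀ {n m s q : ℕ}
    (ends : Ends n m) → Simple ends → Connected ends →
    (T : Subset n) (B : Fin s → Subset n) → IsPartition T B → 2 ≤ s →
    LeastPrimeBetween s q →
    (θ : Fin n → ℤ) → IsTheta q T B θ →
    (μ : Fin m → Fin n → ℤ) → IsMu ends μ →
    (S : Subset n) (F : Subset m) → S ⊆ T →
    (LinIndep q ends T θ μ S F ⇔
    (∀ (Z : Subset n) → IsComponent ends F Z →
    IsInducedTree ends F Z ×
    (∀ j → ∣ Z ∩ B j ∣ ≤ 1) ×
    ∣ Z ∩ T ∣ + ∣ Z ∩ S ∣ ≤ 2))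
lemma3 ends _ _ T B partition _ (q-prime , _) θ θ-blocks μ μ-signs S F S⊆T = mk⇔
  (λ independent Z component →
    to (conditions Z) (Forward.independent⇒admissible ends μ μ-signs T θ S S⊆T F q-prime independent Z component))
  (λ conditions-hold →
    Backward.admissible⇒independent ends μ μ-signs T θ S S⊆T F q-prime
      (λ Z component → from (conditions Z) (conditions-hold Z component)))
  where
  open import Function.Bundles using (mk⇔; Equivalence)
  open Equivalence using (to; from)
  conditions = admissible⇔conditions {θ = θ} {ends = ends} {S = S} {F = F} partition θ-blocks S⊆T
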